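{- Let $r\geq 5$ and $1\leq h\leq r-4$ be integers. Let $\mathcal{G}'$ be the edge-labelled graph on the $2r-1$ vertices $t_0,t_1,\dots,t_{r+h}$ and $s_{2h+3},s_{2h+4},\dots,s_{r+h}$ with the following edges: for each $j=0,\dots,r+h-1$, an edge $\{t_j,t_{j+1}\}$ of label $|j-h|$ (so the labels along this path read $h,\dots,1,0,1,\dots,h,h+1,h+2,\dots,r-1$); for each $j=2h+3,\dots,r+h-1$, an edge $\{s_j,s_{j+1}\}$ of label $j-h$ (labels $h+3,\dots,r-1$); and for each $j=2h+3,\dots,r+h$, an edge $\{t_j,s_j\}$ of label $h+1$. Then $\mathcal{G}'$ is not a CPR graph, although the group it represents is isomorphic to $S_{2r-1}$.
   Context: A string C-group of rank $r$ is a group $G$ with an ordered sequence $(\rho_0,\dots,\rho_{r-1})$ of involutions generating $G$ such that $(\rho_i\rho_j)^2=1$ whenever $|i-j|\geq2$ and $\langle \rho_i : i\in I\rangle\cap\langle\rho_j : j\in J\rangle=\langle \rho_k : k\in I\cap J\rangle$ for all $I,J\subseteq\{0,\dots,r-1\}$. An edge-labelled multigraph on a finite set $\Omega$ with labels $0,\dots,r-1$, in which each vertex lies on at most one edge of each label and each label occurs, determines involutions $\rho_l\in\mathrm{Sym}(\Omega)$, $\rho_l$ being the product of the transpositions $(a\,b)$ over the edges $\{a,b\}$ of label $l$; the group it represents is $\langle\rho_0,\dots,\rho_{r-1}\rangle$, and the graph is a CPR graph if this group with generating sequence $(\rho_0,\dots,\rho_{r-1})$ is a string C-group. -}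

module Defs where

open import Data.Nat using (ℕ; zero; suc; _+_; _*_; _∸_; _≡ᵇ_)
open import Data.Bool using (Bool; true; false; if_then_else_; _∧_)
open import Data.Fin using (Fin; toℕ)
open import Data.Fin.Subset using (Subset; _∈_; _∩_)
open import Data.Fin.Permutation using (Permutation′; _⟨$⟩ʳ_; _∘ₚ_)
open import Data.List using (List; []; _∷_; map; upTo; _++_)
open import Data.List.Relation.Unary.All using (All)
open import Data.Product using (Σ; _×_; _,_; ∃)
open import Relation.Binary.PropositionalEquality using (_≡_)
open import Relation.Nullary using (¬_)

record Edge : Set where
  constructor edge
  field
    label : ℕ
    end₁  : ℕ
    end₂  : ℕ

-- The involution ρ_l determined by the graph: x is sent to its neighbour
-- along the (unique) edge of label l through x, and fixed if there is none.
-- When every vertex lies on at most one edge of each label, this is exactly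
-- the product of the transpositions (a b) over the edges {a,b} of label l.
-- (Points outside Ω are fixed.)
edgeInvolution : List Edge → ℕ → ℕ → ℕ
edgeInvolution [] l x = x
edgeInvolution (edge k a b ∷ es) l x =
  if (k ≡ᵇ l) ∧ (x ≡ᵇ a) then b
  else if (k ≡ᵇ l) ∧ (x ≡ᵇ b) then a
  else edgeInvolution es l x

generators : (r : ℕ) → List Edge → Fin r → ℕ → ℕ
generators r es i = edgeInvolution es (toℕ i)

-- Subgroups generated by a subfamily of generators.
-- Group elements are maps ℕ → ℕ, equal when pointwise equal.

_≐_ : (ℕ → ℕ) → (ℕ → ℕ) → Set
f ≐ g = ∀ x → f x ≡ g x

idMap : ℕ → ℕ
idMap x = x

evalWord : {r : ℕ} → (Fin r → ℕ → ℕ) → List (Fin r) → ℕ → ℕ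
evalWord ρ [] x = x
evalWord ρ (i ∷ w) x = ρ i (evalWord ρ w x)

-- f ∈ ⟨ρ_i : i ∈ I⟩.  Since the ρ_i are involutions of a finite set, the
-- subgroup they generate is the set of products of them (no inverses needed).
InSubgroup : {r : ℕ} → (Fin r → ℕ → ℕ) → Subset r → (ℕ → ℕ) → Set
InSubgroup {r} ρ I f = Σ (List (Fin r)) λ w → All (λ i → i ∈ I) w × (evalWord ρ w ≐ f)

InGroup : {r : ℕ} → (Fin r → ℕ → ℕ) → (ℕ → ℕ) → Set
InGroup {r} ρ f = Σ (List (Fin r)) λ w → evalWord ρ w ≐ f

-- String C-group (the group is, by construction, generated by the ρ_i).

absDiff : ℕ → ℕ → ℕ
absDiff i j = (i ∸ j) + (j ∸ i)

record IsStringCGroup {r : ℕ} (ρ : Fin r → ℕ → ℕ) : Set where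
  field
    involution    : ∀ i → (λ x → ρ i (ρ i x)) ≐ idMap
    nontrivial    : ∀ i → ¬ (ρ i ≐ idMap)
    string        : ∀ i j → 2 Data.Nat.≤ absDiff (toℕ i) (toℕ j) →
                    (λ x → ρ i (ρ j x)) ≐ (λ x → ρ j (ρ i x))
    intersection  : ∀ (I J : Subset r) (f : ℕ → ℕ) →
                    InSubgroup ρ I f → InSubgroup ρ J f → InSubgroup ρ (I ∩ J) f

IsCPRGraph : (r : ℕ) → List Edge → Set
IsCPRGraph r es = IsStringCGroup (generators r es)

-- The group generated by ρ is isomorphic to the symmetric group S_n:
-- an injective homomorphism φ : Sym(Fin n) → maps, with image exactly G.
-- (σ ∘ₚ τ applies σ first, then τ.)

record IsoToSymmetric {r : ℕ} (ρ : Fin r → ℕ → ℕ) (n : ℕ) : Set where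
  field
    φ          : Permutation′ n → ℕ → ℕ
    hom        : ∀ σ τ → φ (σ ∘ₚ τ) ≐ (λ x → φ τ (φ σ x))
    injective  : ∀ σ τ → φ σ ≐ φ τ → ∀ i → σ ⟨$⟩ʳ i ≡ τ ⟨$⟩ʳ i
    into       : ∀ σ → InGroup ρ (φ σ)
    onto       : ∀ f → InGroup ρ f → Σ (Permutation′ n) λ σ → φ σ ≐ f

-- The graph G' (parameters r, h).
-- Vertex encoding: t_j ↦ j  (0 ≤ j ≤ r+h),
--                  s_j ↦ r+h+1 + (j - (2h+3))  (2h+3 ≤ j ≤ r+h).
-- Total 2r-1 vertices: {0,…,2r-2}.

tV : ℕ → ℕ → ℕ → ℕ
tV r h j = j

sV : ℕ → ℕ → ℕ → ℕ
sV r h j = suc (r + h) + (j ∸ (2 * h + 3))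

range : ℕ → ℕ → (ℕ → Edge) → List Edge
range a b f = map (λ k → f (a + k)) (upTo (b ∸ a))

G′ : ℕ → ℕ → List Edge
G′ r h =
  range 0 (r + h) (λ j → edge (absDiff j h) (tV r h j) (tV r h (suc j)))
  ++ range (2 * h + 3) (r + h) (λ j → edge (j ∸ h) (sV r h j) (sV r h (suc j)))
  ++ range (2 * h + 3) (suc (r + h)) (λ j → edge (suc h) (tV r h j) (sV r h j))

{-# OPTIONS --safe #-}
-- Let c = 2h+3, so that {t_c, s_c} is the first rung of the ladder, and let I omit the
-- label h+2 and J the label 0.  The transposition (t_{2h+1} t_{2h+2}) lies in ⟨ρ_I⟩:
-- ρ₁, …, ρ_h carry ρ₀ = (t_h t_{h+1}) out to (t₀ t_{2h+1}), and ρ_{h+1} moves t_{2h+1} to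
-- t_{2h+2}.  It lies in ⟨ρ_J⟩, being obtained from ρ_{h+2} = (t_{2h+2} t_c) by conjugating
-- with ρ_{h+1}, ρ_h, ρ_{h+1} and composing.  But it is not in ⟨ρ_{I∩J}⟩: every element of
-- that group permutes t₀, …, t_{c-1}, and the parity of this permutation tells on which side
-- of the ladder t_c is sent, because ρ_{h+1} is the only generator changing either and it
-- changes both; (t_{2h+1} t_{2h+2}) is odd on t₀, …, t_{c-1} and fixes t_c.
-- Conjugating the same transposition along the path by generators fixing t_{2h+2}, and across
-- the rungs by ρ_{h+1}, gives every transposition of the 2r-1 vertices, so the group is S_{2r-1}.
module Submission where

open import Defs
open import Algebra.Bundles using (CommutativeRing)
open import Data.Bool using (Bool; true; false; if_then_else_; _∧_; _xor_; not)
open import Data.Bool.Properties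
  using (T-≡; ¬-not; xor-∧-commutativeRing; xor-identityʳ; xor-comm; true-xor; ∧-comm; ∧-zeroʳ; not-involutive)
open import Data.Empty using (⊥-elim)
open import Data.Fin using (Fin; toℕ; fromℕ<)
open import Data.Fin.Properties
  using (toℕ-fromℕ<; fromℕ<-toℕ; toℕ<n; toℕ-injective) renaming (_≟_ to _≟ᶠ_)
open import Data.Fin.Permutation
  using (Permutation′; _⟨$⟩ʳ_; _∘ₚ_; permutation; transpose) renaming (id to idₚ)
import Data.Fin.Permutation.Components as Components
open import Data.Fin.Permutation.Transposition.List
  using (TranspositionList; eval; decompose; eval-decompose)
open import Data.Fin.Subset using (Subset; _∈_; _∩_; ⊤; ∁; ⁅_⁆)
open import Data.Fin.Subset.Properties
  using (∈⊤; x∈⁅x⁆; x≢y⇒x∉⁅y⁆; x∉p⇒x∈∁p; x∈∁p⇒x∉p; x∈p∩q⁻)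
open import Data.List using (List; []; _∷_; _++_; applyUpTo)
open import Data.List.Properties using (map-upTo)
open import Data.List.Membership.Propositional.Properties
  using (∈-++⁺ˡ; ∈-++⁺ʳ; ∈-applyUpTo⁺)
open import Data.List.Membership.Propositional using () renaming (_∈_ to _∈ₗ_)
open import Data.List.Relation.Unary.All using (All; []; _∷_) renaming (lookup to lookupAll)
import Data.List.Relation.Unary.All.Properties as All
open import Data.List.Relation.Unary.Any using (here; there)
open import Data.Nat
  using (ℕ; zero; suc; _+_; _*_; _∸_; _≤_; _<_; _≡ᵇ_; _<ᵇ_; z≤n; s≤s; z<s; s<s)
open import Data.Nat.Properties
open import Data.Nat.Tactic.RingSolver using (solve-∀)
open import Data.Product using (Σ; ∃; _×_; _,_; proj₁; proj₂)
open import Data.Sum using (_⊎_; inj₁; inj₂)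
open import Data.Unit using (tt) renaming (⊤ to Unit)
open import Function using (_∘_; id)
open import Function.Bundles using (Equivalence)
open import Relation.Binary.Definitions using (tri<; tri≈; tri>)
open import Relation.Binary.PropositionalEquality
  using (_≡_; _≢_; refl; sym; trans; cong; cong₂; subst; subst₂; module ≡-Reasoning)
open import Relation.Nullary using (¬_; yes; no; _because_; ofʸ; ofⁿ)

open import Algebra.Properties.CommutativeSemigroup
  (CommutativeRing.+-commutativeSemigroup xor-∧-commutativeRing) using (interchange)

≡ᵇ-refl : ∀ n → (n ≡ᵇ n) ≡ true
≡ᵇ-refl n = Equivalence.to T-≡ (≡⇒≡ᵇ n n refl)

≡⇒≡ᵇ-true : ∀ {m n} → m ≡ n → (m ≡ᵇ n) ≡ true
≡⇒≡ᵇ-true {m} refl = ≡ᵇ-refl m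

≢⇒≡ᵇ-false : ∀ {m n} → m ≢ n → (m ≡ᵇ n) ≡ false
≢⇒≡ᵇ-false {m} {n} m≢n = ¬-not (m≢n ∘ ≡ᵇ⇒≡ m n ∘ Equivalence.from T-≡)

<⇒<ᵇ-true : ∀ {m n} → m < n → (m <ᵇ n) ≡ true
<⇒<ᵇ-true = Equivalence.to T-≡ ∘ <⇒<ᵇ

≤⇒<ᵇ-false : ∀ {m n} → n ≤ m → (m <ᵇ n) ≡ false
≤⇒<ᵇ-false {m} {n} n≤m = ¬-not (≤⇒≯ n≤m ∘ <ᵇ⇒< m n ∘ Equivalence.from T-≡)

n≢1+n : ∀ n → n ≢ suc n
n≢1+n n = <⇒≢ (n<1+n n)

swap : ℕ → ℕ → ℕ → ℕ
swap a b x = if x ≡ᵇ a then b else if x ≡ᵇ b then a else x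

swap-left : ∀ a b → swap a b a ≡ b
swap-left a b rewrite ≡ᵇ-refl a = refl

swap-right : ∀ a b → swap a b b ≡ a
swap-right a b with b ≟ a
... | yes refl rewrite ≡ᵇ-refl b = refl
... | no b≢a rewrite ≢⇒≡ᵇ-false b≢a | ≡ᵇ-refl b = refl

swap-other : ∀ {a b x} → x ≢ a → x ≢ b → swap a b x ≡ x
swap-other x≢a x≢b rewrite ≢⇒≡ᵇ-false x≢a | ≢⇒≡ᵇ-false x≢b = refl

swap-self : ∀ a x → swap a a x ≡ x
swap-self a x with x ≟ a
... | yes refl = swap-left x x
... | no x≢a = swap-other x≢a x≢a

swap-comm : ∀ a b x → swap a b x ≡ swap b a x
swap-comm a b x with x ≟ a | x ≟ b
... | yes refl | _ = trans (swap-left x b) (sym (swap-right b x))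
... | no _ | yes refl = trans (swap-right a x) (sym (swap-left x a))
... | no x≢a | no x≢b = trans (swap-other x≢a x≢b) (sym (swap-other x≢b x≢a))

swap-involutive : ∀ a b x → swap a b (swap a b x) ≡ x
swap-involutive a b x with x ≟ a | x ≟ b
... | yes refl | _ = trans (cong (swap x b) (swap-left x b)) (swap-right x b)
... | no _ | yes refl = trans (cong (swap a x) (swap-right a x)) (swap-left a x)
... | no x≢a | no x≢b = trans (cong (swap a b) (swap-other x≢a x≢b)) (swap-other x≢a x≢b)

swap-preserves : ∀ (P : ℕ → Set) {a b x} → P a → P b → P x → P (swap a b x)
swap-preserves P {a} {b} {x} pa pb px with x ≟ a | x ≟ b
... | yes refl | _ = subst P (sym (swap-left x b)) pb
... | no _ | yes refl = subst P (sym (swap-right a x)) pa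
... | no x≢a | no x≢b = subst P (sym (swap-other x≢a x≢b)) px

swap-conjugate : ∀ (g : ℕ → ℕ) → (∀ x → g (g x) ≡ x) →
                 ∀ a b x → g (swap a b (g x)) ≡ swap (g a) (g b) x
swap-conjugate g g-inv a b x with x ≟ g a | x ≟ g b
... | yes refl | _ rewrite g-inv a = trans (cong g (swap-left a b)) (sym (swap-left (g a) (g b)))
... | no _ | yes refl rewrite g-inv b = trans (cong g (swap-right a b)) (sym (swap-right (g a) (g b)))
... | no x≢ga | no x≢gb = begin
    g (swap a b (g x)) ≡⟨ cong g (swap-other (x≢ga ∘ moved) (x≢gb ∘ moved)) ⟩
    g (g x)            ≡⟨ g-inv x ⟩
    x                  ≡⟨ sym (swap-other x≢ga x≢gb) ⟩
    swap (g a) (g b) x ∎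
  where
  open ≡-Reasoning
  moved : ∀ {y} → g x ≡ y → x ≡ g y
  moved refl = sym (g-inv x)

swapAll : List (ℕ × ℕ) → ℕ → ℕ
swapAll [] x = x
swapAll ((a , b) ∷ ps) x = if x ≡ᵇ a then b else if x ≡ᵇ b then a else swapAll ps x

Avoids : ℕ → List (ℕ × ℕ) → Set
Avoids x = All λ p → x ≢ proj₁ p × x ≢ proj₂ p

IsMatching : List (ℕ × ℕ) → Set
IsMatching [] = Unit
IsMatching ((a , b) ∷ ps) = a ≢ b × Avoids a ps × Avoids b ps × IsMatching ps

swapAll-avoids : ∀ {x ps} → Avoids x ps → swapAll ps x ≡ x
swapAll-avoids [] = refl
swapAll-avoids ((x≢a , x≢b) ∷ avoids) rewrite ≢⇒≡ᵇ-false x≢a | ≢⇒≡ᵇ-false x≢b = swapAll-avoids avoids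

swapAll-avoids-image : ∀ {x y ps} → Avoids y ps → swapAll ps x ≡ y → x ≡ y
swapAll-avoids-image [] eq = eq
swapAll-avoids-image {x} {ps = (a , b) ∷ ps} ((y≢a , y≢b) ∷ avoids) eq with x ≟ a | x ≟ b
... | yes refl | _ rewrite ≡ᵇ-refl x = ⊥-elim (y≢b (sym eq))
... | no x≢a | yes refl rewrite ≢⇒≡ᵇ-false x≢a | ≡ᵇ-refl x = ⊥-elim (y≢a (sym eq))
... | no x≢a | no x≢b rewrite ≢⇒≡ᵇ-false x≢a | ≢⇒≡ᵇ-false x≢b = swapAll-avoids-image avoids eq

swapAll-involutive : ∀ {ps} → IsMatching ps → ∀ x → swapAll ps (swapAll ps x) ≡ x
swapAll-involutive {[]} _ x = refl
swapAll-involutive {(a , b) ∷ ps} (a≢b , a-avoids , b-avoids , matching) x with x ≟ a | x ≟ b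
... | yes refl | _ rewrite ≡ᵇ-refl x | ≢⇒≡ᵇ-false (a≢b ∘ sym) | ≡ᵇ-refl b = refl
... | no x≢a | yes refl rewrite ≢⇒≡ᵇ-false x≢a | ≡ᵇ-refl x | ≡ᵇ-refl a = refl
... | no x≢a | no x≢b
  rewrite ≢⇒≡ᵇ-false x≢a | ≢⇒≡ᵇ-false x≢b
        | ≢⇒≡ᵇ-false (x≢a ∘ swapAll-avoids-image a-avoids)
        | ≢⇒≡ᵇ-false (x≢b ∘ swapAll-avoids-image b-avoids) = swapAll-involutive matching x

swapAll-∷ : ∀ {a b ps} → IsMatching ((a , b) ∷ ps) →
            ∀ x → swapAll ((a , b) ∷ ps) x ≡ swap a b (swapAll ps x)
swapAll-∷ {a} {b} {ps} (_ , a-avoids , b-avoids , _) x with x ≟ a | x ≟ b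
... | yes refl | _ rewrite swapAll-avoids a-avoids = refl
... | no x≢a | yes refl rewrite swapAll-avoids b-avoids = refl
... | no x≢a | no x≢b rewrite ≢⇒≡ᵇ-false x≢a | ≢⇒≡ᵇ-false x≢b =
  sym (swap-other (x≢a ∘ swapAll-avoids-image a-avoids) (x≢b ∘ swapAll-avoids-image b-avoids))

swapAll-∈ : ∀ {a b ps} → IsMatching ps → (a , b) ∈ₗ ps → swapAll ps a ≡ b
swapAll-∈ {a} (_ , _) (here refl) rewrite ≡ᵇ-refl a = refl
swapAll-∈ {a} {ps = (c , d) ∷ ps} (_ , c-avoids , d-avoids , matching) (there ab∈ps)
  rewrite ≢⇒≡ᵇ-false (proj₁ (lookupAll c-avoids ab∈ps) ∘ sym)
        | ≢⇒≡ᵇ-false (proj₁ (lookupAll d-avoids ab∈ps) ∘ sym) = swapAll-∈ matching ab∈ps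

swapAll-∈⁻ : ∀ {a b ps} → IsMatching ps → (a , b) ∈ₗ ps → swapAll ps b ≡ a
swapAll-∈⁻ {a} {ps = ps} matching ab∈ps =
  trans (cong (swapAll ps) (sym (swapAll-∈ matching ab∈ps))) (swapAll-involutive matching a)

applyUpTo-isMatching : ∀ (u v : ℕ → ℕ) n → (∀ {k k'} → k < n → k' < n → u k ≢ v k') →
                       (∀ {k k'} → u k ≡ u k' → k ≡ k') → (∀ {k k'} → v k ≡ v k' → k ≡ k') →
                       IsMatching (applyUpTo (λ k → u k , v k) n)
applyUpTo-isMatching u v zero _ _ _ = tt
applyUpTo-isMatching u v (suc n) u≢v u-inj v-inj =
  u≢v z<s z<s ,
  All.applyUpTo⁺₁ _ n (λ i<n → (λ eq → 0≢1+n (u-inj eq)) , u≢v z<s (s<s i<n)) ,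
  All.applyUpTo⁺₁ _ n (λ i<n → (λ eq → u≢v (s<s i<n) z<s (sym eq)) , (λ eq → 0≢1+n (v-inj eq))) ,
  applyUpTo-isMatching (u ∘ suc) (v ∘ suc) n (λ k<n k'<n → u≢v (s<s k<n) (s<s k'<n))
    (suc-injective ∘ u-inj) (suc-injective ∘ v-inj)

open Edge using (label; end₁; end₂)

ends : Edge → ℕ × ℕ
ends e = end₁ e , end₂ e

labelled : ℕ → List Edge → List (ℕ × ℕ)
labelled l [] = []
labelled l (e ∷ es) = if label e ≡ᵇ l then ends e ∷ labelled l es else labelled l es

labelled-++ : ∀ l es fs → labelled l (es ++ fs) ≡ labelled l es ++ labelled l fs
labelled-++ l [] fs = refl
labelled-++ l (e ∷ es) fs with label e ≡ᵇ l
... | true = cong (ends e ∷_) (labelled-++ l es fs)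
... | false = labelled-++ l es fs

∈-labelled : ∀ {e es} → e ∈ₗ es → ends e ∈ₗ labelled (label e) es
∈-labelled {e} (here refl) rewrite ≡ᵇ-refl (label e) = here refl
∈-labelled {e} {f ∷ es} (there e∈es) with label f ≡ᵇ label e
... | true = there (∈-labelled e∈es)
... | false = ∈-labelled e∈es

module _ {l : ℕ} where

  labelled-none : ∀ (F : ℕ → Edge) n → (∀ {k} → k < n → label (F k) ≢ l) →
                  labelled l (applyUpTo F n) ≡ []
  labelled-none F zero _ = refl
  labelled-none F (suc n) other rewrite ≢⇒≡ᵇ-false (other z<s) = labelled-none (F ∘ suc) n (other ∘ s<s)

  labelled-one : ∀ (F : ℕ → Edge) n {k₀} → k₀ < n → label (F k₀) ≡ l →
                 (∀ {k} → k < n → k ≢ k₀ → label (F k) ≢ l) →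
                 labelled l (applyUpTo F n) ≡ ends (F k₀) ∷ []
  labelled-one F (suc n) {zero} _ hit other rewrite ≡⇒≡ᵇ-true hit =
    cong (ends (F 0) ∷_) (labelled-none (F ∘ suc) n (λ k<n → other (s<s k<n) λ ()))
  labelled-one F (suc n) {suc k₀} (s<s k₀<n) hit other rewrite ≢⇒≡ᵇ-false (other z<s λ ()) =
    labelled-one (F ∘ suc) n k₀<n hit (λ k<n k≢k₀ → other (s<s k<n) (k≢k₀ ∘ suc-injective))

  labelled-two : ∀ (F : ℕ → Edge) n {k₀ k₁} → k₀ < k₁ → k₁ < n →
                 label (F k₀) ≡ l → label (F k₁) ≡ l →
                 (∀ {k} → k < n → k ≢ k₀ → k ≢ k₁ → label (F k) ≢ l) →
                 labelled l (applyUpTo F n) ≡ ends (F k₀) ∷ ends (F k₁) ∷ []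
  labelled-two F (suc n) {zero} {suc k₁} _ (s<s k₁<n) hit₀ hit₁ other rewrite ≡⇒≡ᵇ-true hit₀ =
    cong (ends (F 0) ∷_)
      (labelled-one (F ∘ suc) n k₁<n hit₁ (λ k<n k≢k₁ → other (s<s k<n) (λ ()) (k≢k₁ ∘ suc-injective)))
  labelled-two F (suc n) {suc k₀} {suc k₁} (s<s k₀<k₁) (s<s k₁<n) hit₀ hit₁ other
    rewrite ≢⇒≡ᵇ-false (other z<s (λ ()) (λ ())) =
    labelled-two (F ∘ suc) n k₀<k₁ k₁<n hit₀ hit₁
      (λ k<n k≢k₀ k≢k₁ → other (s<s k<n) (k≢k₀ ∘ suc-injective) (k≢k₁ ∘ suc-injective))

  labelled-all : ∀ (F : ℕ → Edge) n → (∀ k → label (F k) ≡ l) →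
                 labelled l (applyUpTo F n) ≡ applyUpTo (ends ∘ F) n
  labelled-all F zero _ = refl
  labelled-all F (suc n) hit rewrite ≡⇒≡ᵇ-true (hit 0) =
    cong (ends (F 0) ∷_) (labelled-all (F ∘ suc) n (hit ∘ suc))

edgeInvolution-labelled : ∀ es l x → edgeInvolution es l x ≡ swapAll (labelled l es) x
edgeInvolution-labelled [] l x = refl
edgeInvolution-labelled (e ∷ es) l x with label e ≡ᵇ l
... | true = cong (λ y → if x ≡ᵇ end₁ e then end₂ e else if x ≡ᵇ end₂ e then end₁ e else y)
                  (edgeInvolution-labelled es l x)
... | false = edgeInvolution-labelled es l x

module _ {es : List Edge} {l : ℕ} (matching : IsMatching (labelled l es)) where

  edgeInvolution-involutive : ∀ x → edgeInvolution es l (edgeInvolution es l x) ≡ x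
  edgeInvolution-involutive x = begin
    edgeInvolution es l (edgeInvolution es l x) ≡⟨ edgeInvolution-labelled es l _ ⟩
    swapAll (labelled l es) (edgeInvolution es l x)
      ≡⟨ cong (swapAll (labelled l es)) (edgeInvolution-labelled es l x) ⟩
    swapAll (labelled l es) (swapAll (labelled l es) x) ≡⟨ swapAll-involutive matching x ⟩
    x ∎
    where open ≡-Reasoning

  edgeInvolution-∈ : ∀ {a b} → edge l a b ∈ₗ es → edgeInvolution es l a ≡ b
  edgeInvolution-∈ e∈es = trans (edgeInvolution-labelled es l _) (swapAll-∈ matching (∈-labelled e∈es))

  edgeInvolution-∈⁻ : ∀ {a b} → edge l a b ∈ₗ es → edgeInvolution es l b ≡ a
  edgeInvolution-∈⁻ e∈es = trans (edgeInvolution-labelled es l _) (swapAll-∈⁻ matching (∈-labelled e∈es))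

edgeInvolution-avoids : ∀ {es l x} → All (λ e → x ≢ end₁ e × x ≢ end₂ e) es → edgeInvolution es l x ≡ x
edgeInvolution-avoids [] = refl
edgeInvolution-avoids {e ∷ es} {l} ((x≢a , x≢b) ∷ avoids)
  rewrite ≢⇒≡ᵇ-false x≢a | ≢⇒≡ᵇ-false x≢b | ∧-zeroʳ (label e ≡ᵇ l) = edgeInvolution-avoids avoids

-- Parity of the number of inversions

xorSum : ℕ → (ℕ → Bool) → Bool
xorSum zero f = false
xorSum (suc n) f = xorSum n f xor f n

xorSum-cong : ∀ n {f g : ℕ → Bool} → (∀ {i} → i < n → f i ≡ g i) → xorSum n f ≡ xorSum n g
xorSum-cong zero _ = refl
xorSum-cong (suc n) f≗g = cong₂ _xor_ (xorSum-cong n (f≗g ∘ m<n⇒m<1+n)) (f≗g (n<1+n n))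

xorSum-xor : ∀ n (f g : ℕ → Bool) → xorSum n (λ i → f i xor g i) ≡ xorSum n f xor xorSum n g
xorSum-xor zero f g = refl
xorSum-xor (suc n) f g rewrite xorSum-xor n f g = interchange (xorSum n f) (xorSum n g) (f n) (g n)

xorSum-false : ∀ n → xorSum n (λ _ → false) ≡ false
xorSum-false zero = refl
xorSum-false (suc n) rewrite xorSum-false n = refl

xorSum-indicator : ∀ n a (b : ℕ → Bool) → xorSum n (λ i → (i ≡ᵇ a) ∧ b i) ≡ (a <ᵇ n) ∧ b a
xorSum-indicator zero a b = refl
xorSum-indicator (suc n) a b with <-cmp a n
... | tri< a<n _ _
  rewrite xorSum-indicator n a b | <⇒<ᵇ-true a<n | <⇒<ᵇ-true (m<n⇒m<1+n a<n)
        | ≢⇒≡ᵇ-false (<⇒≢ a<n ∘ sym) = xor-identityʳ (b a)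
... | tri≈ _ refl _
  rewrite xorSum-indicator a a b | ≤⇒<ᵇ-false (≤-refl {a}) | <⇒<ᵇ-true (n<1+n a) | ≡ᵇ-refl a = refl
... | tri> _ _ n<a
  rewrite xorSum-indicator n a b | ≤⇒<ᵇ-false (<⇒≤ n<a) | ≤⇒<ᵇ-false n<a | ≢⇒≡ᵇ-false (<⇒≢ n<a) = refl

inversionParity : ℕ → (ℕ → ℕ) → Bool
inversionParity n g = xorSum n λ j → xorSum j λ i → g j <ᵇ g i

inversionParity-cong : ∀ n {f g : ℕ → ℕ} → (∀ {i} → i < n → f i ≡ g i) →
                       inversionParity n f ≡ inversionParity n g
inversionParity-cong n f≗g =
  xorSum-cong n λ j<n → xorSum-cong _ λ i<j → cong₂ _<ᵇ_ (f≗g j<n) (f≗g (<-trans i<j j<n))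

inversionParity-id : ∀ n → inversionParity n id ≡ false
inversionParity-id n = begin
  inversionParity n id                ≡⟨ xorSum-cong n (λ {j} _ → xorSum-cong j (≤⇒<ᵇ-false ∘ <⇒≤)) ⟩
  xorSum n (λ j → xorSum j λ _ → false) ≡⟨ xorSum-cong n (λ {j} _ → xorSum-false j) ⟩
  xorSum n (λ _ → false)              ≡⟨ xorSum-false n ⟩
  false                               ∎
  where open ≡-Reasoning

record PermutesBelow (n : ℕ) (g : ℕ → ℕ) : Set where
  field
    <-closed   : ∀ {i} → i < n → g i < n
    injective  : ∀ {i j} → i < n → j < n → g i ≡ g j → i ≡ j
    surjective : ∀ {y} → y < n → ∃ λ i → i < n × g i ≡ y

PermutesBelow-id : ∀ n → PermutesBelow n id
PermutesBelow-id n = record { <-closed = id ; injective = λ _ _ → id ; surjective = λ {y} y<n → y , y<n , refl }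

PermutesBelow-∘ : ∀ {n g} (σ : ℕ → ℕ) → (∀ x → σ (σ x) ≡ x) → (∀ {x} → x < n → σ x < n) →
                  PermutesBelow n g → PermutesBelow n (σ ∘ g)
PermutesBelow-∘ {g = g} σ σ-inv σ-closed g-perm = record
  { <-closed   = σ-closed ∘ <-closed
  ; injective  = λ i<n j<n eq → injective i<n j<n (trans (sym (σ-inv (g _))) (trans (cong σ eq) (σ-inv (g _))))
  ; surjective = λ y<n → let (i , i<n , gi≡σy) = surjective (σ-closed y<n) in
                           i , i<n , trans (cong σ gi≡σy) (σ-inv _)
  }
  where open PermutesBelow g-perm

isAdjacentPair : ℕ → ℕ → ℕ → Bool
isAdjacentPair k a b = ((a ≡ᵇ k) ∧ (b ≡ᵇ suc k)) xor ((a ≡ᵇ suc k) ∧ (b ≡ᵇ k))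

private
  <ᵇ-suc : ∀ {b k} → b ≢ k → (b <ᵇ suc k) ≡ (b <ᵇ k)
  <ᵇ-suc {b} {k} b≢k with <-cmp b k
  ... | tri< b<k _ _ rewrite <⇒<ᵇ-true b<k | <⇒<ᵇ-true (m<n⇒m<1+n b<k) = refl
  ... | tri≈ _ b≡k _ = ⊥-elim (b≢k b≡k)
  ... | tri> _ _ k<b rewrite ≤⇒<ᵇ-false (<⇒≤ k<b) | ≤⇒<ᵇ-false k<b = refl

  suc-<ᵇ : ∀ {k a} → a ≢ suc k → (suc k <ᵇ a) ≡ (k <ᵇ a)
  suc-<ᵇ {k} {a} a≢sk with <-cmp (suc k) a
  ... | tri< sk<a _ _ rewrite <⇒<ᵇ-true sk<a | <⇒<ᵇ-true (<-trans (n<1+n k) sk<a) = refl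
  ... | tri≈ _ sk≡a _ = ⊥-elim (a≢sk (sym sk≡a))
  ... | tri> _ _ a<sk rewrite ≤⇒<ᵇ-false (<⇒≤ a<sk) | ≤⇒<ᵇ-false (≤-pred a<sk) = refl

isAdjacentPair-up : ∀ k → isAdjacentPair k k (suc k) ≡ true
isAdjacentPair-up k rewrite ≡ᵇ-refl k | ≢⇒≡ᵇ-false (n≢1+n k) = refl

isAdjacentPair-down : ∀ k → isAdjacentPair k (suc k) k ≡ true
isAdjacentPair-down k rewrite ≡ᵇ-refl k | ≢⇒≡ᵇ-false (n≢1+n k ∘ sym) = refl

isAdjacentPair-outˡ : ∀ {k a b} → a ≢ k → a ≢ suc k → isAdjacentPair k a b ≡ false
isAdjacentPair-outˡ a≢k a≢sk rewrite ≢⇒≡ᵇ-false a≢k | ≢⇒≡ᵇ-false a≢sk = refl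

isAdjacentPair-outʳ : ∀ {k a b} → b ≢ k → b ≢ suc k → isAdjacentPair k a b ≡ false
isAdjacentPair-outʳ {k} {a} b≢k b≢sk
  rewrite ≢⇒≡ᵇ-false b≢k | ≢⇒≡ᵇ-false b≢sk | ∧-zeroʳ (a ≡ᵇ k) | ∧-zeroʳ (a ≡ᵇ suc k) = refl

swap-adjacent-<ᵇ : ∀ k {a b} → a ≢ b →
                   (swap k (suc k) b <ᵇ swap k (suc k) a) ≡ (b <ᵇ a) xor isAdjacentPair k a b
swap-adjacent-<ᵇ k {a} {b} a≢b with a ≟ k | a ≟ suc k | b ≟ k | b ≟ suc k
... | yes refl | yes k≡sk | _ | _ = ⊥-elim (n≢1+n k k≡sk)
... | _ | _ | yes refl | yes k≡sk = ⊥-elim (n≢1+n k k≡sk)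
... | yes refl | _ | yes refl | _ = ⊥-elim (a≢b refl)
... | _ | yes refl | _ | yes refl = ⊥-elim (a≢b refl)
... | yes refl | no _ | no _ | yes refl
  rewrite swap-left k (suc k) | swap-right k (suc k) | isAdjacentPair-up k
        | <⇒<ᵇ-true (n<1+n k) | ≤⇒<ᵇ-false (n≤1+n k) = refl
... | no _ | yes refl | yes refl | no _
  rewrite swap-left k (suc k) | swap-right k (suc k) | isAdjacentPair-down k
        | <⇒<ᵇ-true (n<1+n k) | ≤⇒<ᵇ-false (n≤1+n k) = refl
... | yes refl | no _ | no b≢k | no b≢sk
  rewrite swap-left k (suc k) | swap-other b≢k b≢sk | isAdjacentPair-outʳ {k} {k} b≢k b≢sk
        | <ᵇ-suc b≢k = sym (xor-identityʳ _)
... | no a≢k | yes refl | no b≢k | no b≢sk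
  rewrite swap-right k (suc k) | swap-other b≢k b≢sk | isAdjacentPair-outʳ {k} {suc k} b≢k b≢sk
        | <ᵇ-suc b≢k = sym (xor-identityʳ _)
... | no a≢k | no a≢sk | yes refl | no _
  rewrite swap-left k (suc k) | swap-other a≢k a≢sk | isAdjacentPair-outˡ {b = k} a≢k a≢sk
        | suc-<ᵇ a≢sk = sym (xor-identityʳ _)
... | no a≢k | no a≢sk | no _ | yes refl
  rewrite swap-right k (suc k) | swap-other a≢k a≢sk | isAdjacentPair-outˡ {b = suc k} a≢k a≢sk
        | suc-<ᵇ a≢sk = sym (xor-identityʳ _)
... | no a≢k | no a≢sk | no b≢k | no b≢sk
  rewrite swap-other a≢k a≢sk | swap-other b≢k b≢sk | isAdjacentPair-outˡ {b = b} a≢k a≢sk =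
  sym (xor-identityʳ _)

private
  <ᵇ-xor-flip : ∀ {p q} → p ≢ q → (p <ᵇ q) xor (q <ᵇ p) ≡ true
  <ᵇ-xor-flip {p} {q} p≢q with <-cmp p q
  ... | tri< p<q _ _ rewrite <⇒<ᵇ-true p<q | ≤⇒<ᵇ-false (<⇒≤ p<q) = refl
  ... | tri≈ _ p≡q _ = ⊥-elim (p≢q p≡q)
  ... | tri> _ _ q<p rewrite <⇒<ᵇ-true q<p | ≤⇒<ᵇ-false (<⇒≤ q<p) = refl

  xorSum-indicatorʳ : ∀ n a (b : ℕ → Bool) → xorSum n (λ i → b i ∧ (i ≡ᵇ a)) ≡ (a <ᵇ n) ∧ b a
  xorSum-indicatorʳ n a b = trans (xorSum-cong n λ {i} _ → ∧-comm (b i) (i ≡ᵇ a)) (xorSum-indicator n a b)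

module _ {n} {g : ℕ → ℕ} (g-perm : PermutesBelow n g) where
  open PermutesBelow g-perm

  private
    preimage-≡ᵇ : ∀ {p y} → p < n → g p ≡ y → ∀ {i} → i < n → (g i ≡ᵇ y) ≡ (i ≡ᵇ p)
    preimage-≡ᵇ {p} p<n refl {i} i<n with i ≟ p
    ... | yes refl rewrite ≡ᵇ-refl (g i) | ≡ᵇ-refl i = refl
    ... | no i≢p rewrite ≢⇒≡ᵇ-false i≢p = ≢⇒≡ᵇ-false (i≢p ∘ injective i<n p<n)

  -- {p, q} is the only pair of positions whose values change order under swap k (suc k)
  private
    oneAdjacentPair : ∀ {k p q} → p < n → q < n → g p ≡ k → g q ≡ suc k →
                      xorSum n (λ j → xorSum j λ i → isAdjacentPair k (g i) (g j)) ≡ true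
    oneAdjacentPair {k} {p} {q} p<n q<n gp≡k gq≡sk = begin
        xorSum n (λ j → xorSum j λ i → isAdjacentPair k (g i) (g j))
      ≡⟨ xorSum-cong n (λ j<n → xorSum-cong _ λ i<j → let i<n = <-trans i<j j<n in
           cong₂ _xor_ (cong₂ _∧_ (preimage-≡ᵇ p<n gp≡k i<n) (preimage-≡ᵇ q<n gq≡sk j<n))
                       (cong₂ _∧_ (preimage-≡ᵇ q<n gq≡sk i<n) (preimage-≡ᵇ p<n gp≡k j<n))) ⟩
        xorSum n (λ j → xorSum j λ i → ((i ≡ᵇ p) ∧ (j ≡ᵇ q)) xor ((i ≡ᵇ q) ∧ (j ≡ᵇ p)))
      ≡⟨ xorSum-cong n (λ {j} _ → trans (xorSum-xor j _ _)
           (cong₂ _xor_ (xorSum-indicator j p _) (xorSum-indicator j q _))) ⟩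
        xorSum n (λ j → ((p <ᵇ j) ∧ (j ≡ᵇ q)) xor ((q <ᵇ j) ∧ (j ≡ᵇ p)))
      ≡⟨ xorSum-xor n (λ j → (p <ᵇ j) ∧ (j ≡ᵇ q)) (λ j → (q <ᵇ j) ∧ (j ≡ᵇ p)) ⟩
        xorSum n (λ j → (p <ᵇ j) ∧ (j ≡ᵇ q)) xor xorSum n (λ j → (q <ᵇ j) ∧ (j ≡ᵇ p))
      ≡⟨ cong₂ _xor_ (xorSum-indicatorʳ n q (p <ᵇ_)) (xorSum-indicatorʳ n p (q <ᵇ_)) ⟩
        ((q <ᵇ n) ∧ (p <ᵇ q)) xor ((p <ᵇ n) ∧ (q <ᵇ p))
      ≡⟨ cong₂ (λ x y → (x ∧ (p <ᵇ q)) xor (y ∧ (q <ᵇ p))) (<⇒<ᵇ-true q<n) (<⇒<ᵇ-true p<n) ⟩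
        (p <ᵇ q) xor (q <ᵇ p)
      ≡⟨ <ᵇ-xor-flip (λ p≡q → n≢1+n k (trans (sym gp≡k) (trans (cong g p≡q) gq≡sk))) ⟩
        true ∎
      where open ≡-Reasoning

  inversionParity-swap-adjacent : ∀ {k} → suc k < n →
                                  inversionParity n (swap k (suc k) ∘ g) ≡ not (inversionParity n g)
  inversionParity-swap-adjacent {k} sk<n = begin
      inversionParity n (swap k (suc k) ∘ g)
    ≡⟨ xorSum-cong n (λ j<n → xorSum-cong _ λ i<j →
         swap-adjacent-<ᵇ k (<⇒≢ i<j ∘ injective (<-trans i<j j<n) j<n)) ⟩
      xorSum n (λ j → xorSum j λ i → (g j <ᵇ g i) xor isAdjacentPair k (g i) (g j))
    ≡⟨ xorSum-cong n (λ {j} _ → xorSum-xor j _ _) ⟩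
      xorSum n (λ j → xorSum j (λ i → g j <ᵇ g i) xor xorSum j λ i → isAdjacentPair k (g i) (g j))
    ≡⟨ xorSum-xor n _ _ ⟩
      inversionParity n g xor xorSum n (λ j → xorSum j λ i → isAdjacentPair k (g i) (g j))
    ≡⟨ cong (inversionParity n g xor_)
         (let (p , p<n , gp≡k) = surjective (<-trans (n<1+n k) sk<n)
              (q , q<n , gq≡sk) = surjective sk<n
          in oneAdjacentPair p<n q<n gp≡k gq≡sk) ⟩
      inversionParity n g xor true
    ≡⟨ trans (xor-comm _ true) (true-xor _) ⟩
      not (inversionParity n g) ∎
    where open ≡-Reasoning

-- Subgroups generated by involutions

module Generated {r : ℕ} (ρ : Fin r → ℕ → ℕ) (ρ-involutive : ∀ i x → ρ i (ρ i x) ≡ x) where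

  evalWord-++ : ∀ w v x → evalWord ρ (w ++ v) x ≡ evalWord ρ w (evalWord ρ v x)
  evalWord-++ [] v x = refl
  evalWord-++ (i ∷ w) v x = cong (ρ i) (evalWord-++ w v x)

  module _ {I : Subset r} where

    InSubgroup-id : InSubgroup ρ I id
    InSubgroup-id = [] , [] , λ _ → refl

    InSubgroup-∘ : ∀ {f g} → InSubgroup ρ I f → InSubgroup ρ I g → InSubgroup ρ I (f ∘ g)
    InSubgroup-∘ {f} (w , w∈I , w≐f) (v , v∈I , v≐g) =
      w ++ v , All.++⁺ w∈I v∈I , λ x → trans (evalWord-++ w v x) (trans (w≐f _) (cong f (v≐g x)))

    InSubgroup-ρ : ∀ {i} → i ∈ I → InSubgroup ρ I (ρ i)
    InSubgroup-ρ i∈I = _ ∷ [] , i∈I ∷ [] , λ _ → refl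

    InSubgroup-≐ : ∀ {f g} → InSubgroup ρ I f → f ≐ g → InSubgroup ρ I g
    InSubgroup-≐ (w , w∈I , w≐f) f≐g = w , w∈I , λ x → trans (w≐f x) (f≐g x)

  ρ-back : ∀ {i x y} → ρ i x ≡ y → ρ i y ≡ x
  ρ-back {i} refl = ρ-involutive i _

  Transposes : Subset r → ℕ → ℕ → Set
  Transposes I a b = InSubgroup ρ I (swap a b)

  module _ {I : Subset r} where

    transposes-ρ : ∀ {i a b} → i ∈ I → ρ i ≐ swap a b → Transposes I a b
    transposes-ρ i∈I = InSubgroup-≐ (InSubgroup-ρ i∈I)

    transposes-refl : ∀ a → Transposes I a a
    transposes-refl a = InSubgroup-≐ InSubgroup-id (sym ∘ swap-self a)

    transposes-sym : ∀ {a b} → Transposes I a b → Transposes I b a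
    transposes-sym {a} {b} t = InSubgroup-≐ t (swap-comm a b)

    transposes-conj : ∀ {i a b} → i ∈ I → Transposes I a b → Transposes I (ρ i a) (ρ i b)
    transposes-conj {i} {a} {b} i∈I t =
      InSubgroup-≐ (InSubgroup-∘ (InSubgroup-ρ i∈I) (InSubgroup-∘ t (InSubgroup-ρ i∈I)))
                   (swap-conjugate (ρ i) (ρ-involutive i) a b)

    transposes-trans : ∀ {a b c} → Transposes I a b → Transposes I b c → Transposes I a c
    transposes-trans {a} {b} {c} t-ab t-bc with c ≟ a | c ≟ b
    ... | yes refl | _ = transposes-refl c
    ... | no _ | yes refl = t-ab
    ... | no c≢a | no c≢b = InSubgroup-≐ (InSubgroup-∘ t-ab (InSubgroup-∘ t-bc t-ab)) λ x → begin
        swap a b (swap b c (swap a b x)) ≡⟨ swap-conjugate (swap a b) (swap-involutive a b) b c x ⟩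
        swap (swap a b b) (swap a b c) x ≡⟨ cong₂ (λ u v → swap u v x) (swap-right a b) (swap-other c≢a c≢b) ⟩
        swap a c x                       ∎
      where open ≡-Reasoning

    transposes-walk : ∀ (f g : ℕ → ℕ) n → Transposes I (f 0) (g 0) →
                      (∀ {k} → k < n → ∃ λ i → i ∈ I × ρ i (f k) ≡ f (suc k) × ρ i (g k) ≡ g (suc k)) →
                      Transposes I (f n) (g n)
    transposes-walk f g zero t _ = t
    transposes-walk f g (suc n) t step with step (n<1+n n)
    ... | i , i∈I , f-step , g-step =
      subst₂ (Transposes I) f-step g-step
        (transposes-conj i∈I (transposes-walk f g n t (step ∘ m<n⇒m<1+n)))

    transposes-walk⁻ : ∀ (f g : ℕ → ℕ) n → Transposes I (f n) (g n) →
                       (∀ {k} → k < n → ∃ λ i → i ∈ I × ρ i (f k) ≡ f (suc k) × ρ i (g k) ≡ g (suc k)) →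
                       Transposes I (f 0) (g 0)
    transposes-walk⁻ f g zero t _ = t
    transposes-walk⁻ f g (suc n) t step with step (n<1+n n)
    ... | i , i∈I , f-step , g-step =
      transposes-walk⁻ f g n
        (subst₂ (Transposes I) (ρ-back f-step) (ρ-back g-step) (transposes-conj i∈I t)) (step ∘ m<n⇒m<1+n)

extend : ∀ {n} → Permutation′ n → ℕ → ℕ
extend {n} σ x with x <? n
... | yes x<n = toℕ (σ ⟨$⟩ʳ fromℕ< x<n)
... | no _ = x

module _ {n : ℕ} where

  extend-toℕ : ∀ (σ : Permutation′ n) i → extend σ (toℕ i) ≡ toℕ (σ ⟨$⟩ʳ i)
  extend-toℕ σ i with toℕ i <? n
  ... | yes i<n = cong (λ j → toℕ (σ ⟨$⟩ʳ j)) (fromℕ<-toℕ i i<n)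
  ... | no i≮n = ⊥-elim (i≮n (toℕ<n i))

  extend-≮ : ∀ (σ : Permutation′ n) {x} → ¬ x < n → extend σ x ≡ x
  extend-≮ σ {x} x≮n with x <? n
  ... | yes x<n = ⊥-elim (x≮n x<n)
  ... | no _ = refl

  extend-cong : ∀ {σ τ : Permutation′ n} → (∀ i → σ ⟨$⟩ʳ i ≡ τ ⟨$⟩ʳ i) → extend σ ≐ extend τ
  extend-cong σ≗τ x with x <? n
  ... | yes x<n = cong toℕ (σ≗τ (fromℕ< x<n))
  ... | no _ = refl

  extend-id : extend (idₚ {n = n}) ≐ idMap
  extend-id x with x <? n
  ... | yes x<n = toℕ-fromℕ< x<n
  ... | no _ = refl

  extend-∘ₚ : ∀ (σ τ : Permutation′ n) → extend (σ ∘ₚ τ) ≐ (extend τ ∘ extend σ)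
  extend-∘ₚ σ τ x with x <? n
  ... | yes x<n = sym (extend-toℕ τ (σ ⟨$⟩ʳ fromℕ< x<n))
  ... | no x≮n = sym (extend-≮ τ x≮n)

  extend-transpose : ∀ (i j : Fin n) → extend (transpose i j) ≐ swap (toℕ i) (toℕ j)
  extend-transpose i j x with x <? n
  ... | yes x<n = trans (toℕ-transpose (fromℕ< x<n)) (cong (swap (toℕ i) (toℕ j)) (toℕ-fromℕ< x<n))
    where
    toℕ-transpose : ∀ k → toℕ (Components.transpose i j k) ≡ swap (toℕ i) (toℕ j) (toℕ k)
    toℕ-transpose k with k ≟ᶠ i
    ... | true because ofʸ refl = sym (swap-left (toℕ k) (toℕ j))
    ... | false because ofⁿ k≢i with k ≟ᶠ j
    ... | true because ofʸ refl = sym (swap-right (toℕ i) (toℕ k))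
    ... | false because ofⁿ k≢j = sym (swap-other (k≢i ∘ toℕ-injective) (k≢j ∘ toℕ-injective))
  ... | no x≮n = sym (swap-other (x≮n ∘ λ x≡i → subst (_< n) (sym x≡i) (toℕ<n i))
                                 (x≮n ∘ λ x≡j → subst (_< n) (sym x≡j) (toℕ<n j)))

module _ {r n : ℕ} (ρ : Fin r → ℕ → ℕ) (ρ-involutive : ∀ i x → ρ i (ρ i x) ≡ x) where
  open Generated ρ ρ-involutive

  extend-InSubgroup : (∀ {a b} → a < n → b < n → Transposes ⊤ a b) → ∀ σ → InSubgroup ρ ⊤ (extend σ)
  extend-InSubgroup transposes σ = InSubgroup-≐ (extend-eval (decompose σ)) (extend-cong (eval-decompose σ))
    where
    extend-eval : ∀ (ts : TranspositionList n) → InSubgroup ρ ⊤ (extend (eval ts))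
    extend-eval [] = InSubgroup-≐ InSubgroup-id (sym ∘ extend-id {n})
    extend-eval ((i , j) ∷ ts) =
      InSubgroup-≐ (InSubgroup-∘ (extend-eval ts) (transposes (toℕ<n i) (toℕ<n j)))
                   λ x → sym (trans (extend-∘ₚ (transpose i j) (eval ts) x)
                                    (cong (extend (eval ts)) (extend-transpose i j x)))

  module _ (ρ-fixes : ∀ i {x} → ¬ x < n → ρ i x ≡ x) where

    ρ-<-closed : ∀ i {x} → x < n → ρ i x < n
    ρ-<-closed i {x} x<n with ρ i x <? n
    ... | yes ρx<n = ρx<n
    ... | no ρx≮n = ⊥-elim (ρx≮n (subst (_< n) (trans (sym (ρ-involutive i x)) (ρ-fixes i ρx≮n)) x<n))

    ρ-perm : Fin r → Permutation′ n
    ρ-perm i = permutation ρᶠ ρᶠ ρᶠ-involutive ρᶠ-involutive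
      where
      ρᶠ : Fin n → Fin n
      ρᶠ k = fromℕ< (ρ-<-closed i (toℕ<n k))
      ρᶠ-involutive : ∀ k → ρᶠ (ρᶠ k) ≡ k
      ρᶠ-involutive k = toℕ-injective
        (trans (toℕ-fromℕ< _) (trans (cong (ρ i) (toℕ-fromℕ< _)) (ρ-involutive i (toℕ k))))

    extend-ρ-perm : ∀ i → extend (ρ-perm i) ≐ ρ i
    extend-ρ-perm i x with x <? n
    ... | yes x<n = trans (toℕ-fromℕ< _) (cong (ρ i) (toℕ-fromℕ< x<n))
    ... | no x≮n = sym (ρ-fixes i x≮n)

    evalWord-extend : ∀ w → Σ (Permutation′ n) λ σ → extend σ ≐ evalWord ρ w
    evalWord-extend [] = idₚ , extend-id {n}
    evalWord-extend (i ∷ w) = let (σ , σ≐w) = evalWord-extend w in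
      σ ∘ₚ ρ-perm i ,
      λ x → trans (extend-∘ₚ σ (ρ-perm i) x) (trans (extend-ρ-perm i _) (cong (ρ i) (σ≐w x)))

    isoToSymmetric : (∀ {a b} → a < n → b < n → Transposes ⊤ a b) → IsoToSymmetric ρ n
    isoToSymmetric transposes = record
      { φ         = extend
      ; hom       = extend-∘ₚ
      ; injective = λ σ τ σ≐τ i →
          toℕ-injective (trans (sym (extend-toℕ σ i)) (trans (σ≐τ (toℕ i)) (extend-toℕ τ i)))
      ; into      = λ σ → let (w , _ , w≐σ) = extend-InSubgroup transposes σ in w , w≐σ
      ; onto      = λ f (w , w≐f) → let (σ , σ≐w) = evalWord-extend w in σ , λ x → trans (σ≐w x) (w≐f x)
      }

applyUpTo-cong : ∀ {A : Set} {f g : ℕ → A} n → (∀ k → f k ≡ g k) → applyUpTo f n ≡ applyUpTo g n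
applyUpTo-cong zero _ = refl
applyUpTo-cong (suc n) f≗g = cong₂ _∷_ (f≗g 0) (applyUpTo-cong n (f≗g ∘ suc))

absDiff-+ : ∀ h l → absDiff (h + l) h ≡ l
absDiff-+ h l rewrite m+n∸m≡n h l | m≤n⇒m∸n≡0 (m≤m+n h l) = +-identityʳ l

absDiff-+ˡ : ∀ {a l h} → a + l ≡ h → absDiff a h ≡ l
absDiff-+ˡ {a} {l} refl rewrite m≤n⇒m∸n≡0 (m≤m+n a l) = m+n∸m≡n a l

absDiff-inv : ∀ {j h l} → absDiff j h ≡ l → j ≡ h + l ⊎ j + l ≡ h
absDiff-inv {j} {h} refl with h ≤? j
... | yes h≤j rewrite m≤n⇒m∸n≡0 h≤j | +-identityʳ (j ∸ h) = inj₁ (sym (m+[n∸m]≡n h≤j))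
... | no h≰j rewrite m≤n⇒m∸n≡0 (<⇒≤ (≰⇒> h≰j)) = inj₂ (m+[n∸m]≡n (<⇒≤ (≰⇒> h≰j)))

absDiff-inv-> : ∀ {j h l} → h < l → absDiff j h ≡ l → j ≡ h + l
absDiff-inv-> {j} {h} {l} h<l eq with absDiff-inv eq
... | inj₁ j≡h+l = j≡h+l
... | inj₂ j+l≡h = ⊥-elim (<⇒≱ h<l (subst (l ≤_) j+l≡h (m≤n+m l j)))

private
  last-t : ∀ h m → h + 4 + m + h ≡ 2 * h + 3 + suc m
  last-t = solve-∀

  rung-of-high : ∀ h k → k + (2 * h + 3) ≡ h + (3 + h + k)
  rung-of-high = solve-∀

  first-rung : ∀ h → 2 * h + 3 ≡ suc (suc (h + suc h))
  first-rung = solve-∀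

  vertex-count : ∀ h m → 2 * (h + 4 + m) ≡ suc (suc (suc m + suc (h + 4 + m + h)))
  vertex-count = solve-∀

  four-in-front : ∀ h m → h + 4 + m ≡ suc (3 + h + m)
  four-in-front = solve-∀

  high-bound : ∀ h m k → 3 + h + k < h + 4 + m → k ≤ m
  high-bound h m k lt = +-cancelˡ-≤ (3 + h) k m (≤-pred (subst (4 + h + k ≤_) (four-in-front h m) lt))

module Graph (h m : ℕ) (1≤h : 1 ≤ h) where

  -- The vertex t_j is j and s k is s_{c+k}; t₁ and t₂ are t_{2h+1} and t_{2h+2}.

  r T c t₁ t₂ : ℕ
  r = h + 4 + m
  T = r + h
  c = 2 * h + 3
  t₁ = h + suc h
  t₂ = suc t₁

  s : ℕ → ℕ
  s k = k + suc T

  top : ℕ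
  top = s (suc m)

  ρ : ℕ → ℕ → ℕ
  ρ = edgeInvolution (G′ r h)

  pathEdge sEdge rungEdge : ℕ → Edge
  pathEdge j = edge (absDiff j h) j (suc j)
  sEdge k = edge (3 + h + k) (s k) (s (suc k))
  rungEdge k = edge (suc h) (k + c) (s k)

  T≡c+ : T ≡ c + suc m
  T≡c+ = last-t h m

  c≡suc-t₂ : c ≡ suc t₂
  c≡suc-t₂ = first-rung h

  c≤T : c ≤ T
  c≤T = subst (c ≤_) (sym T≡c+) (m≤m+n c (suc m))

  sV≡s : ∀ k → sV r h (c + k) ≡ s k
  sV≡s k = trans (cong (suc T +_) (m+n∸m≡n c k)) (+-comm (suc T) k)

  G′-≡ : G′ r h ≡ applyUpTo pathEdge T ++ applyUpTo sEdge (suc m) ++ applyUpTo rungEdge (2 + m)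
  G′-≡ = cong₂ _++_ (map-upTo _ T) (cong₂ _++_
    (trans (map-upTo _ (T ∸ c)) (trans (cong (applyUpTo _) T∸c) (applyUpTo-cong (suc m) sEdge-≡)))
    (trans (map-upTo _ (suc T ∸ c)) (trans (cong (applyUpTo _) suc-T∸c) (applyUpTo-cong (2 + m) rungEdge-≡))))
    where
    T∸c : T ∸ c ≡ suc m
    T∸c = trans (cong (_∸ c) T≡c+) (m+n∸m≡n c (suc m))
    suc-T∸c : suc T ∸ c ≡ 2 + m
    suc-T∸c = trans (+-∸-assoc 1 c≤T) (cong suc T∸c)
    sEdge-≡ : ∀ k → edge ((c + k) ∸ h) (sV r h (c + k)) (sV r h (suc (c + k))) ≡ sEdge k
    sEdge-≡ k rewrite sym (+-suc c k) | sV≡s k | sV≡s (suc k) | +-comm c k | rung-of-high h k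
                    | m+n∸m≡n h (3 + h + k) = refl
    rungEdge-≡ : ∀ k → edge (suc h) (c + k) (sV r h (c + k)) ≡ rungEdge k
    rungEdge-≡ k = cong₂ (edge (suc h)) (+-comm c k) (sV≡s k)

  T<s : ∀ k → T < s k
  T<s k = m≤n+m (suc T) k

  s-injective : ∀ {k k'} → s k ≡ s k' → k ≡ k'
  s-injective = +-cancelʳ-≡ (suc T) _ _

  s≤top : ∀ {k} → k < 2 + m → s k ≤ top
  s≤top k<2+m = +-monoˡ-≤ (suc T) (≤-pred k<2+m)

  rung≤T : ∀ {k} → k < 2 + m → k + c ≤ T
  rung≤T {k} k<2+m = subst₂ _≤_ (+-comm c k) (sym T≡c+) (+-monoʳ-≤ c (≤-pred k<2+m))

  t₂<c : t₂ < c
  t₂<c = subst (t₂ <_) (sym c≡suc-t₂) (n<1+n t₂)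

  t₁<c : t₁ < c
  t₁<c = <-trans (n<1+n t₁) t₂<c

  ≤3+h⇒<r : ∀ {l} → l ≤ 3 + h → l < r
  ≤3+h⇒<r l≤3+h = ≤-trans (s≤s l≤3+h) (subst (_≤ r) (+-comm h 4) (m≤m+n (h + 4) m))

  0<r : 0 < r
  0<r = ≤3+h⇒<r z≤n

  h<r : h < r
  h<r = ≤3+h⇒<r (m≤n+m h 3)

  1+h<r : suc h < r
  1+h<r = ≤3+h⇒<r (m≤n+m (suc h) 2)

  2+h<r : 2 + h < r
  2+h<r = ≤3+h⇒<r (n≤1+n _)

  high<r : ∀ {k} → k ≤ m → 3 + h + k < r
  high<r {k} k≤m = subst (4 + h + k ≤_) (cong (_+ m) (+-comm 4 h)) (+-monoʳ-≤ (4 + h) k≤m)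

  h+<T : ∀ {l} → l < r → h + l < T
  h+<T {l} l<r = subst (h + l <_) (+-comm h r) (+-monoʳ-< h l<r)

  rung<T⇒≤m : ∀ {k} → k + c < T → k ≤ m
  rung<T⇒≤m {k} k+c<T =
    ≤-pred (+-cancelʳ-< c k (suc m) (subst (k + c <_) (trans T≡c+ (+-comm c (suc m))) k+c<T))

  rung-index : ∀ {y} → c ≤ y → y ≤ T → ∃ λ k → k < 2 + m × k + c ≡ y
  rung-index {y} c≤y y≤T = y ∸ c , k<2+m , m∸n+n≡m c≤y
    where
    k<2+m : y ∸ c < 2 + m
    k<2+m = s≤s (+-cancelʳ-≤ c (y ∸ c) (suc m)
              (subst₂ _≤_ (sym (m∸n+n≡m c≤y)) (trans T≡c+ (+-comm c (suc m))) y≤T))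

  s-index : ∀ {y} → T < y → y ≤ top → ∃ λ k → k < 2 + m × s k ≡ y
  s-index {y} T<y y≤top =
    y ∸ suc T , s≤s (+-cancelʳ-≤ (suc T) _ (suc m) (subst (_≤ top) (sym s≡y) y≤top)) , s≡y
    where
    s≡y : s (y ∸ suc T) ≡ y
    s≡y = m∸n+n≡m T<y

  ladder : List (ℕ × ℕ)
  ladder = applyUpTo (λ k → k + c , s k) (2 + m)

  ladder-avoids : ∀ {x} → x < c → Avoids x ladder
  ladder-avoids x<c = All.applyUpTo⁺₁ _ (2 + m) λ {k} _ →
    (<⇒≢ (≤-trans x<c (m≤n+m c k))) , <⇒≢ (<-trans (≤-trans x<c c≤T) (T<s k))

  ladder-isMatching : IsMatching ladder
  ladder-isMatching = applyUpTo-isMatching (_+ c) s (2 + m)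
    (λ k<2+m _ → <⇒≢ (≤-<-trans (rung≤T k<2+m) (T<s _))) (+-cancelʳ-≡ c _ _) s-injective

  low-index<h : ∀ {a d} → a + suc d ≡ h → a < h
  low-index<h {a} {d} a+sd≡h = subst (a <_) (trans (sym (+-suc a d)) a+sd≡h) (s≤s (m≤m+n a d))

  low-label≤h : ∀ {a d} → a + suc d ≡ h → suc d ≤ h
  low-label≤h {a} {d} a+sd≡h = subst (suc d ≤_) a+sd≡h (m≤n+m (suc d) a)

  -- low a d: the label d+1 ≤ h, carried by the path edges at t_a and t_{h+d+1}
  data Label : ℕ → Set where
    origin : Label 0
    low    : ∀ a d → a + suc d ≡ h → Label (suc d)
    mid    : Label (suc h)
    joint  : Label (2 + h)
    high   : ∀ k → k ≤ m → Label (3 + h + k)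
    unused : ∀ {l} → r ≤ l → Label l

  classify : ∀ l → Label l
  classify zero = origin
  classify (suc d) with suc d ≤? h
  ... | yes sd≤h = low (h ∸ suc d) d (m∸n+n≡m sd≤h)
  ... | no sd≰h with d ≟ h
  ... | yes refl = mid
  ... | no d≢h with d ≟ suc h
  ... | yes refl = joint
  ... | no d≢sh with suc d <? r
  ... | no sd≮r = unused (≮⇒≥ sd≮r)
  ... | yes sd<r = subst Label sd≡ (high (d ∸ (2 + h)) (high-bound h m _ (subst (_< r) (sym sd≡) sd<r)))
    where
    2+h≤d : 2 + h ≤ d
    2+h≤d = ≤∧≢⇒< (≤∧≢⇒< (≤-pred (≰⇒> sd≰h)) (d≢h ∘ sym)) (d≢sh ∘ sym)
    sd≡ : 3 + h + (d ∸ (2 + h)) ≡ suc d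
    sd≡ = cong suc (m+[n∸m]≡n 2+h≤d)

  private
    paths sEdges rungs : List Edge
    paths = applyUpTo pathEdge T
    sEdges = applyUpTo sEdge (suc m)
    rungs = applyUpTo rungEdge (2 + m)

    labelled-G′ : ∀ l → labelled l (G′ r h) ≡ labelled l paths ++ labelled l sEdges ++ labelled l rungs
    labelled-G′ l = trans (cong (labelled l) G′-≡)
      (trans (labelled-++ l paths _) (cong (labelled l paths ++_) (labelled-++ l sEdges rungs)))

    high≢ : ∀ {l} k → l ≤ 2 + h → 3 + h + k ≢ l
    high≢ k l≤2+h eq = <⇒≢ (s≤s (≤-trans l≤2+h (m≤m+n (2 + h) k))) (sym eq)

    labelled-G′-≡ : ∀ {l xs ys zs} →
                    labelled l paths ≡ xs → labelled l sEdges ≡ ys → labelled l rungs ≡ zs →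
                    labelled l (G′ r h) ≡ xs ++ ys ++ zs
    labelled-G′-≡ {l} xs≡ ys≡ zs≡ = trans (labelled-G′ l) (cong₂ _++_ xs≡ (cong₂ _++_ ys≡ zs≡))

  labelled-origin : labelled 0 (G′ r h) ≡ (h , suc h) ∷ []
  labelled-origin = labelled-G′-≡
    (labelled-one pathEdge T {h} (m<n+m h (≤-<-trans z≤n h<r)) (absDiff-+ˡ (+-identityʳ h)) (λ _ → only-h))
    (labelled-none {0} sEdge (suc m) (λ _ ()))
    (labelled-none {0} rungEdge (2 + m) (λ _ ()))
    where
    only-h : ∀ {j} → j ≢ h → absDiff j h ≢ 0
    only-h {j} j≢h eq with absDiff-inv eq
    ... | inj₁ j≡h+0 = j≢h (trans j≡h+0 (+-identityʳ h))
    ... | inj₂ j+0≡h = j≢h (trans (sym (+-identityʳ j)) j+0≡h)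

  labelled-low : ∀ {a d} → a + suc d ≡ h →
                 labelled (suc d) (G′ r h) ≡ (a , suc a) ∷ (h + suc d , suc (h + suc d)) ∷ []
  labelled-low {a} {d} a+sd≡h = labelled-G′-≡
    (labelled-two pathEdge T {a} {h + suc d} a<h+sd (h+<T (≤-<-trans sd≤h h<r))
              (absDiff-+ˡ a+sd≡h) (absDiff-+ h (suc d)) (λ _ → only-a-or-h+sd))
    (labelled-none sEdge (suc m) (λ {k} _ → high≢ k (≤-trans sd≤h (m≤n+m h 2))))
    (labelled-none rungEdge (2 + m) (λ _ eq → <⇒≢ (s≤s sd≤h) (sym eq)))
    where
    sd≤h : suc d ≤ h
    sd≤h = low-label≤h a+sd≡h
    a<h+sd : a < h + suc d
    a<h+sd = <-trans (low-index<h a+sd≡h) (m<m+n h z<s)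
    only-a-or-h+sd : ∀ {j} → j ≢ a → j ≢ h + suc d → absDiff j h ≢ suc d
    only-a-or-h+sd {j} j≢a j≢h+sd eq with absDiff-inv eq
    ... | inj₁ j≡h+sd = j≢h+sd j≡h+sd
    ... | inj₂ j+sd≡h = j≢a (+-cancelʳ-≡ (suc d) j a (trans j+sd≡h (sym a+sd≡h)))

  labelled-mid : labelled (suc h) (G′ r h) ≡ (t₁ , t₂) ∷ ladder
  labelled-mid = labelled-G′-≡
    (labelled-one pathEdge T {t₁} (h+<T (≤3+h⇒<r (m≤n+m (suc h) 2))) (absDiff-+ h (suc h))
              (λ _ j≢t₁ eq → j≢t₁ (absDiff-inv-> (n<1+n h) eq)))
    (labelled-none sEdge (suc m) (λ {k} _ → high≢ k (n≤1+n _)))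
    (labelled-all rungEdge (2 + m) (λ _ → refl))

  labelled-joint : labelled (2 + h) (G′ r h) ≡ (t₂ , suc t₂) ∷ []
  labelled-joint = labelled-G′-≡
    (labelled-one pathEdge T {t₂} (subst (_< T) (+-suc h (suc h)) (h+<T (≤3+h⇒<r (n≤1+n _))))
              (subst (λ j → absDiff j h ≡ 2 + h) (+-suc h (suc h)) (absDiff-+ h (2 + h)))
              (λ _ j≢t₂ eq → j≢t₂ (trans (absDiff-inv-> (≤-trans (n<1+n h) (n≤1+n _)) eq) (+-suc h (suc h)))))
    (labelled-none sEdge (suc m) (λ {k} _ → high≢ k ≤-refl))
    (labelled-none rungEdge (2 + m) (λ _ eq → <⇒≢ (n<1+n (suc h)) eq))

  labelled-high : ∀ {k} → k ≤ m →
                  labelled (3 + h + k) (G′ r h) ≡ (k + c , suc (k + c)) ∷ (s k , suc (s k)) ∷ []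
  labelled-high {k} k≤m = labelled-G′-≡
    (labelled-one pathEdge T {k + c} (subst (_< T) (sym (rung-of-high h k)) (h+<T l<r))
              (subst (λ j → absDiff j h ≡ 3 + h + k) (sym (rung-of-high h k)) (absDiff-+ h (3 + h + k)))
              (λ _ j≢k+c eq → j≢k+c (trans (absDiff-inv-> (<-≤-trans (m<n+m h z<s) (m≤m+n (3 + h) k)) eq)
                                           (sym (rung-of-high h k)))))
    (labelled-one sEdge (suc m) {k} (s≤s k≤m) refl (λ _ k'≢k eq → k'≢k (+-cancelˡ-≡ (3 + h) _ _ eq)))
    (labelled-none rungEdge (2 + m) (λ _ → high≢ k (n≤1+n _) ∘ sym))
    where
    l<r : 3 + h + k < r
    l<r = high<r k≤m

  labelled-unused : ∀ {l} → r ≤ l → labelled l (G′ r h) ≡ []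
  labelled-unused {l} r≤l = labelled-G′-≡
    (labelled-none pathEdge T (λ j<T eq → <⇒≱ (path-label<r j<T) (subst (r ≤_) (sym eq) r≤l)))
    (labelled-none sEdge (suc m) (λ k<sm eq → <⇒≱ (high<r (≤-pred k<sm)) (subst (r ≤_) (sym eq) r≤l)))
    (labelled-none rungEdge (2 + m) (λ _ eq → <⇒≱ 1+h<r (subst (r ≤_) (sym eq) r≤l)))
    where
    path-label<r : ∀ {j} → j < T → absDiff j h < r
    path-label<r {j} j<T with absDiff-inv {j} {h} refl
    ... | inj₁ j≡h+l = +-cancelˡ-< h _ r (subst (_< h + r) j≡h+l (subst (j <_) (+-comm r h) j<T))
    ... | inj₂ j+l≡h = ≤-<-trans (subst (absDiff j h ≤_) j+l≡h (m≤n+m _ j)) h<r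

  private
    adjacent-pairs-isMatching : ∀ {a b} → suc a < b → IsMatching ((a , suc a) ∷ (b , suc b) ∷ [])
    adjacent-pairs-isMatching {a} {b} sa<b =
      n≢1+n a ,
      (<⇒≢ (<-trans (n<1+n a) sa<b) , <⇒≢ (<-trans (<-trans (n<1+n a) sa<b) (n<1+n b))) ∷ [] ,
      (<⇒≢ sa<b , <⇒≢ (<-trans sa<b (n<1+n b))) ∷ [] ,
      n≢1+n b , [] , [] , tt

    low-gap : ∀ {a d} → a + suc d ≡ h → suc a < h + suc d
    low-gap a+sd≡h = ≤-<-trans (low-index<h a+sd≡h) (m<m+n _ z<s)

    high-gap : ∀ {k} → k ≤ m → suc (k + c) < s k
    high-gap {k} k≤m = ≤-<-trans (rung≤T (s≤s (s≤s k≤m))) (T<s k)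

  ρ-isMatching : ∀ l → IsMatching (labelled l (G′ r h))
  ρ-isMatching l with classify l
  ... | origin = subst IsMatching (sym labelled-origin) (n≢1+n h , [] , [] , tt)
  ... | low a d a+sd≡h =
    subst IsMatching (sym (labelled-low a+sd≡h)) (adjacent-pairs-isMatching (low-gap a+sd≡h))
  ... | mid = subst IsMatching (sym labelled-mid)
                (n≢1+n t₁ , ladder-avoids t₁<c , ladder-avoids t₂<c , ladder-isMatching)
  ... | joint = subst IsMatching (sym labelled-joint) (n≢1+n t₂ , [] , [] , tt)
  ... | high k k≤m = subst IsMatching (sym (labelled-high k≤m)) (adjacent-pairs-isMatching (high-gap k≤m))
  ... | unused r≤l = subst IsMatching (sym (labelled-unused r≤l)) tt

  ρ-involutive : ∀ l x → ρ l (ρ l x) ≡ x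
  ρ-involutive l = edgeInvolution-involutive {G′ r h} (ρ-isMatching l)

  private
    ρ-≐ : ∀ {l ps} → labelled l (G′ r h) ≡ ps → ρ l ≐ swapAll ps
    ρ-≐ {l} eq x = trans (edgeInvolution-labelled (G′ r h) l x) (cong (λ ps → swapAll ps x) eq)

  ρ-origin : ρ 0 ≐ swap h (suc h)
  ρ-origin = ρ-≐ labelled-origin

  ρ-low : ∀ {a d} → a + suc d ≡ h → ρ (suc d) ≐ (swap a (suc a) ∘ swap (h + suc d) (suc (h + suc d)))
  ρ-low a+sd≡h x =
    trans (ρ-≐ (labelled-low a+sd≡h) x) (swapAll-∷ (adjacent-pairs-isMatching (low-gap a+sd≡h)) x)

  ρ-mid : ρ (suc h) ≐ (swap t₁ t₂ ∘ swapAll ladder)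
  ρ-mid x = trans (ρ-≐ labelled-mid x)
    (swapAll-∷ (n≢1+n t₁ , ladder-avoids t₁<c , ladder-avoids t₂<c , ladder-isMatching) x)

  ρ-joint : ρ (2 + h) ≐ swap t₂ c
  ρ-joint x = trans (ρ-≐ labelled-joint x) (cong (λ y → swap t₂ y x) (sym c≡suc-t₂))

  ρ-high : ∀ {k} → k ≤ m → ρ (3 + h + k) ≐ (swap (k + c) (suc (k + c)) ∘ swap (s k) (suc (s k)))
  ρ-high k≤m x = trans (ρ-≐ (labelled-high k≤m) x) (swapAll-∷ (adjacent-pairs-isMatching (high-gap k≤m)) x)

  private
    ∈-G′ : ∀ {e} → e ∈ₗ paths ++ sEdges ++ rungs → e ∈ₗ G′ r h
    ∈-G′ = subst (_ ∈ₗ_) (sym G′-≡)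

  ρ-path : ∀ {j l} → j < T → absDiff j h ≡ l → ρ l j ≡ suc j
  ρ-path j<T refl = edgeInvolution-∈ (ρ-isMatching _) (∈-G′ (∈-++⁺ˡ (∈-applyUpTo⁺ pathEdge j<T)))

  ρ-path⁻ : ∀ {j l} → j < T → absDiff j h ≡ l → ρ l (suc j) ≡ j
  ρ-path⁻ j<T refl = edgeInvolution-∈⁻ (ρ-isMatching _) (∈-G′ (∈-++⁺ˡ (∈-applyUpTo⁺ pathEdge j<T)))

  ρ-rung : ∀ {k} → k < 2 + m → ρ (suc h) (k + c) ≡ s k
  ρ-rung k<2+m = edgeInvolution-∈ (ρ-isMatching _)
    (∈-G′ (∈-++⁺ʳ paths (∈-++⁺ʳ sEdges (∈-applyUpTo⁺ rungEdge k<2+m))))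

  ρ-rung⁻ : ∀ {k} → k < 2 + m → ρ (suc h) (s k) ≡ k + c
  ρ-rung⁻ k<2+m = edgeInvolution-∈⁻ (ρ-isMatching _)
    (∈-G′ (∈-++⁺ʳ paths (∈-++⁺ʳ sEdges (∈-applyUpTo⁺ rungEdge k<2+m))))

  T≤top : T ≤ top
  T≤top = <⇒≤ (<-≤-trans (T<s 0) (s≤top z<s))

  ρ-fixes-beyond : ∀ l {x} → top < x → ρ l x ≡ x
  ρ-fixes-beyond l {x} top<x = edgeInvolution-avoids
    (subst (All _) (sym G′-≡) (All.++⁺ paths-avoid (All.++⁺ sEdges-avoid rungs-avoid)))
    where
    far : ∀ {y} → y ≤ top → x ≢ y
    far y≤top x≡y = <⇒≱ top<x (subst (_≤ top) (sym x≡y) y≤top)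
    paths-avoid = All.applyUpTo⁺₁ pathEdge T λ j<T →
      far (≤-trans (<⇒≤ j<T) T≤top) , far (≤-trans j<T T≤top)
    sEdges-avoid = All.applyUpTo⁺₁ sEdge (suc m) λ k<sm →
      far (s≤top (m<n⇒m<1+n k<sm)) , far (s≤top (s≤s k<sm))
    rungs-avoid = All.applyUpTo⁺₁ rungEdge (2 + m) λ k<2+m →
      far (≤-trans (rung≤T k<2+m) T≤top) , far (s≤top k<2+m)

  ρ-mid-front : ∀ {x} → x < c → ρ (suc h) x ≡ swap t₁ t₂ x
  ρ-mid-front x<c = trans (ρ-mid _) (cong (swap t₁ t₂) (swapAll-avoids (ladder-avoids x<c)))

  low-edge<t₁ : ∀ {a d} → a + suc d ≡ h → suc (h + suc d) ≤ t₁
  low-edge<t₁ {d = d} a+sd≡h =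
    subst (suc (h + suc d) ≤_) (sym (+-suc h h)) (s≤s (+-monoʳ-≤ h (low-label≤h a+sd≡h)))

  ρ-low-fixes : ∀ {l x} → l ≤ h → t₁ < x → ρ l x ≡ x
  ρ-low-fixes {l} {x} l≤h t₁<x with classify l
  ... | origin = trans (ρ-origin x) (swap-other (far (m≤m+n h (suc h))) (far (m≤n+m (suc h) h)))
    where
    far : ∀ {y} → y ≤ t₁ → x ≢ y
    far y≤t₁ = >⇒≢ (≤-<-trans y≤t₁ t₁<x)
  ... | low a d a+sd≡h = trans (ρ-low a+sd≡h x)
        (trans (cong (swap a (suc a)) (swap-other (far (<⇒≤ b<t₁)) (far b<t₁)))
               (swap-other (far (<⇒≤ a<t₁)) (far a<t₁)))
    where
    far : ∀ {y} → y ≤ t₁ → x ≢ y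
    far y≤t₁ = >⇒≢ (≤-<-trans y≤t₁ t₁<x)
    b<t₁ : suc (h + suc d) ≤ t₁
    b<t₁ = low-edge<t₁ a+sd≡h
    a<t₁ : suc a ≤ t₁
    a<t₁ = ≤-trans (low-index<h a+sd≡h) (m≤m+n h (suc h))
  ... | mid = ⊥-elim (1+n≰n l≤h)
  ... | joint = ⊥-elim (1+n≰n (≤-trans (n≤1+n _) l≤h))
  ... | high k _ = ⊥-elim (<⇒≱ (<-≤-trans (m<n+m h z<s) (m≤m+n (3 + h) k)) l≤h)
  ... | unused r≤l = ⊥-elim (<⇒≱ (≤-<-trans l≤h h<r) r≤l)

  -- Transpositions in the group of G′

  open Generated (generators r (G′ r h)) (λ i → ρ-involutive (toℕ i))

  ρ-fromℕ< : ∀ {l} (l<r : l < r) x → generators r (G′ r h) (fromℕ< l<r) x ≡ ρ l x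
  ρ-fromℕ< l<r x = cong (λ l → ρ l x) (toℕ-fromℕ< l<r)

  module _ {I : Subset r} where

    transposes-by : ∀ {l a b} (l<r : l < r) → fromℕ< l<r ∈ I → ρ l ≐ swap a b → Transposes I a b
    transposes-by l<r l∈I ρ≐swap = transposes-ρ l∈I (λ x → trans (ρ-fromℕ< l<r x) (ρ≐swap x))

    conjugate-by : ∀ {l a b a′ b′} (l<r : l < r) → fromℕ< l<r ∈ I → ρ l a ≡ a′ → ρ l b ≡ b′ →
                   Transposes I a b → Transposes I a′ b′
    conjugate-by l<r l∈I a↦a′ b↦b′ t =
      subst₂ (Transposes I) (trans (ρ-fromℕ< l<r _) a↦a′) (trans (ρ-fromℕ< l<r _) b↦b′)
             (transposes-conj l∈I t)

    step-by : ∀ {l x x′ y y′} (l<r : l < r) → fromℕ< l<r ∈ I → ρ l x ≡ x′ → ρ l y ≡ y′ →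
              ∃ λ i → i ∈ I × generators r (G′ r h) i x ≡ x′ × generators r (G′ r h) i y ≡ y′
    step-by l<r l∈I x↦x′ y↦y′ =
      fromℕ< l<r , l∈I , trans (ρ-fromℕ< l<r _) x↦x′ , trans (ρ-fromℕ< l<r _) y↦y′

  high-path-label : ∀ k → absDiff (k + c) h ≡ 3 + h + k
  high-path-label k = trans (cong (λ j → absDiff j h) (rung-of-high h k)) (absDiff-+ h (3 + h + k))

  ρ-high-front : ∀ {k x} → k ≤ m → x < c → ρ (3 + h + k) x ≡ x
  ρ-high-front {k} {x} k≤m x<c = trans (ρ-high k≤m x)
    (trans (cong (swap (k + c) (suc (k + c))) (swap-other (<⇒≢ x<s) (<⇒≢ (<-trans x<s (n<1+n (s k))))))
           (swap-other (<⇒≢ x<k+c) (<⇒≢ (<-trans x<k+c (n<1+n (k + c))))))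
    where
    x<k+c : x < k + c
    x<k+c = <-≤-trans x<c (m≤n+m c k)
    x<s : x < s k
    x<s = <-trans (<-≤-trans x<c c≤T) (T<s k)

  private
    t₁<T : t₁ < T
    t₁<T = h+<T 1+h<r

    h+h<t₁ : h + h < t₁
    h+h<t₁ = subst (h + h <_) (sym (+-suc h h)) (n<1+n (h + h))

    ρ-mid-t₁ : ρ (suc h) t₁ ≡ t₂
    ρ-mid-t₁ = ρ-path t₁<T (absDiff-+ h (suc h))

    ρ-mid-t₂ : ρ (suc h) t₂ ≡ t₁
    ρ-mid-t₂ = ρ-path⁻ t₁<T (absDiff-+ h (suc h))

    ρ-mid-fixes : ∀ {x} → x < t₁ → ρ (suc h) x ≡ x
    ρ-mid-fixes x<t₁ =
      trans (ρ-mid-front (<-trans x<t₁ t₁<c)) (swap-other (<⇒≢ x<t₁) (<⇒≢ (<-trans x<t₁ (n<1+n t₁))))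

  transposes-t₁-t₂-left : ∀ {I} → (∀ {l} (l<r : l < r) → l ≤ suc h → fromℕ< l<r ∈ I) →
                          Transposes I t₁ t₂
  transposes-t₁-t₂-left {I} ∈I = transposes-trans (transposes-sym t₀-t₁) t₀-t₂
    where
    ρ-mirror-left : ∀ {k} → k < h → ρ (suc k) (h ∸ k) ≡ h ∸ suc k
    ρ-mirror-left {k} k<h = trans (cong (ρ (suc k)) (+-∸-assoc 1 k<h))
      (ρ-path⁻ (≤-<-trans (m∸n≤m h (suc k)) (<-trans (m<m+n h z<s) t₁<T)) (absDiff-+ˡ (m∸n+n≡m k<h)))
    ρ-mirror-right : ∀ {k} → k < h → ρ (suc k) (k + suc h) ≡ suc k + suc h
    ρ-mirror-right {k} k<h = ρ-path (<-trans (+-monoˡ-< (suc h) k<h) t₁<T)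
      (trans (cong (λ j → absDiff j h) (trans (+-comm k (suc h)) (sym (+-suc h k)))) (absDiff-+ h (suc k)))
    mirrored : Transposes I (h ∸ h) (h + suc h)
    mirrored = transposes-walk (h ∸_) (_+ suc h) h (transposes-by 0<r (∈I 0<r z≤n) ρ-origin) λ k<h →
      let l<r = ≤3+h⇒<r (≤-trans k<h (m≤n+m h 3)) in
      step-by l<r (∈I l<r (≤-trans k<h (n≤1+n h))) (ρ-mirror-left k<h) (ρ-mirror-right k<h)
    t₀-t₁ : Transposes I 0 t₁
    t₀-t₁ = subst (λ x → Transposes I x t₁) (n∸n≡0 h) mirrored
    t₀-t₂ : Transposes I 0 t₂
    t₀-t₂ = conjugate-by 1+h<r (∈I 1+h<r ≤-refl) (ρ-mid-fixes (≤-<-trans z≤n h+h<t₁)) ρ-mid-t₁ t₀-t₁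

  transposes-t₁-t₂-right : ∀ {I} → (∀ {l} (l<r : l < r) → h ≤ l → l ≤ 2 + h → fromℕ< l<r ∈ I) →
                           Transposes I t₁ t₂
  transposes-t₁-t₂-right {I} ∈I = transposes-trans t₁-2h (transposes-sym t₂-2h)
    where
    h≤2+h : h ≤ 2 + h
    h≤2+h = m≤n+m h 2
    ρh-t₁ : ρ h t₁ ≡ h + h
    ρh-t₁ = trans (cong (ρ h) (+-suc h h)) (ρ-path⁻ (<-trans h+h<t₁ t₁<T) (absDiff-+ h h))
    t₂-c : Transposes I t₂ c
    t₂-c = transposes-by 2+h<r (∈I 2+h<r h≤2+h ≤-refl) ρ-joint
    t₁-s₀ : Transposes I t₁ (s 0)
    t₁-s₀ = conjugate-by 1+h<r (∈I 1+h<r (n≤1+n h) (n≤1+n _)) ρ-mid-t₂ (ρ-rung z<s) t₂-c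
    2h-s₀ : Transposes I (h + h) (s 0)
    2h-s₀ = conjugate-by h<r (∈I h<r ≤-refl h≤2+h) ρh-t₁
              (ρ-low-fixes ≤-refl (<-trans t₁<T (T<s 0))) t₁-s₀
    t₁-2h : Transposes I t₁ (h + h)
    t₁-2h = transposes-trans t₁-s₀ (transposes-sym 2h-s₀)
    t₂-2h : Transposes I t₂ (h + h)
    t₂-2h = conjugate-by 1+h<r (∈I 1+h<r (n≤1+n h) (n≤1+n _)) ρ-mid-t₁ (ρ-mid-fixes h+h<t₁) t₁-2h

  private
    absDiff≤h : ∀ {j} → j < t₁ → absDiff j h ≤ h
    absDiff≤h {j} j<t₁ with absDiff-inv {j} {h} refl
    ... | inj₁ j≡h+l = +-cancelˡ-≤ h _ h (subst (_≤ h + h) j≡h+l (≤-pred (subst (j <_) (+-suc h h) j<t₁)))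
    ... | inj₂ j+l≡h = subst (absDiff j h ≤_) j+l≡h (m≤n+m _ j)

  transposes-t₁-t₂ : Transposes ⊤ t₁ t₂
  transposes-t₁-t₂ = transposes-t₁-t₂-left (λ _ _ → ∈⊤)

  transposes-t₂-left : ∀ {x} → x ≤ t₁ → Transposes ⊤ t₂ x
  transposes-t₂-left {x} x≤t₁ = transposes-sym (transposes-walk⁻ (_+ x) (λ _ → t₂) (t₁ ∸ x)
    (subst (λ y → Transposes ⊤ y t₂) (sym (m∸n+n≡m x≤t₁)) transposes-t₁-t₂) λ {k} k<t₁∸x →
      let k+x<t₁ = subst (k + x <_) (m∸n+n≡m x≤t₁) (+-monoˡ-< x k<t₁∸x) in
      step-by (≤-<-trans (absDiff≤h k+x<t₁) h<r) ∈⊤ (ρ-path (<-trans k+x<t₁ t₁<T) refl)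
        (ρ-low-fixes (absDiff≤h k+x<t₁) (n<1+n t₁)))

  transposes-t₂-right : ∀ {x} → c ≤ x → x ≤ T → Transposes ⊤ t₂ x
  transposes-t₂-right {x} c≤x x≤T = transposes-sym (subst (λ y → Transposes ⊤ y t₂) (m∸n+n≡m c≤x)
    (transposes-walk (_+ c) (λ _ → t₂) (x ∸ c) (transposes-sym (transposes-by 2+h<r ∈⊤ ρ-joint))
      λ {k} k<x∸c →
        let k+c<T = <-≤-trans (subst (k + c <_) (m∸n+n≡m c≤x) (+-monoˡ-< c k<x∸c)) x≤T
            k≤m = rung<T⇒≤m k+c<T
        in step-by (high<r k≤m) ∈⊤ (ρ-path k+c<T (high-path-label k)) (ρ-high-front k≤m t₂<c)))

  transposes-t₂ : ∀ {x} → x ≤ top → Transposes ⊤ t₂ x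
  transposes-t₂ {x} x≤top with x ≤? t₁
  ... | yes x≤t₁ = transposes-t₂-left x≤t₁
  ... | no x≰t₁ with x ≟ t₂
  ... | yes refl = transposes-refl x
  ... | no x≢t₂ with x ≤? T
  ... | yes x≤T = transposes-t₂-right (subst (_≤ x) (sym c≡suc-t₂) (≤∧≢⇒< (≰⇒> x≰t₁) (x≢t₂ ∘ sym))) x≤T
  ... | no x≰T with s-index (≰⇒> x≰T) x≤top
  ... | k , k<2+m , refl = transposes-trans (transposes-sym transposes-t₁-t₂)
        (conjugate-by 1+h<r ∈⊤ ρ-mid-t₂ (ρ-rung k<2+m) (transposes-t₂-right (m≤n+m c k) (rung≤T k<2+m)))

  transposes-top : ∀ {a b} → a ≤ top → b ≤ top → Transposes ⊤ a b
  transposes-top a≤top b≤top = transposes-trans (transposes-sym (transposes-t₂ a≤top)) (transposes-t₂ b≤top)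

  -- The parity invariant of ⟨ρ_l : l ≠ 0, h + 2⟩

  Side : Bool → ℕ → Set
  Side false y = c ≤ y × y ≤ T
  Side true y = T < y × y ≤ top

  c≤-Side : ∀ {b y} → Side b y → c ≤ y
  c≤-Side {false} (c≤y , _) = c≤y
  c≤-Side {true} (T<y , _) = ≤-trans c≤T (<⇒≤ T<y)

  record Respects (σ : ℕ → ℕ) (flips : Bool) : Set where
    field
      front-closed : ∀ {x} → x < c → σ x < c
      front-parity : ∀ {g} → PermutesBelow c g → inversionParity c (σ ∘ g) ≡ flips xor inversionParity c g
      back         : ∀ {b y} → Side b y → Side (flips xor b) (σ y)

  record Linked (g : ℕ → ℕ) : Set where
    field
      front : PermutesBelow c g
      side  : Side (inversionParity c g) (g c)

  Linked-id : Linked id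
  Linked-id = record
    { front = PermutesBelow-id c
    ; side  = subst (λ b → Side b c) (sym (inversionParity-id c)) (≤-refl , c≤T)
    }

  Linked-∘ : ∀ {σ b g} → (∀ x → σ (σ x) ≡ x) → Respects σ b → Linked g → Linked (σ ∘ g)
  Linked-∘ {σ} {b} {g} σ-involutive σ-respects g-linked = record
    { front = PermutesBelow-∘ σ σ-involutive front-closed front
    ; side  = subst (λ b′ → Side b′ (σ (g c))) (sym (front-parity front)) (back side)
    }
    where
    open Respects σ-respects
    open Linked g-linked

  respects-low : ∀ {a d} → a + suc d ≡ h → Respects (ρ (suc d)) false
  respects-low {a} {d} a+sd≡h = record
    { front-closed = λ x<c → subst (_< c) (sym (ρ-low a+sd≡h _)) (swap-a (swap-b x<c))
    ; front-parity = λ {g} g-perm → begin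
        inversionParity c (ρ (suc d) ∘ g)
          ≡⟨ inversionParity-cong c (λ _ → ρ-low a+sd≡h (g _)) ⟩
        inversionParity c (swap a (suc a) ∘ (swap b (suc b) ∘ g))
          ≡⟨ inversionParity-swap-adjacent (PermutesBelow-∘ _ (swap-involutive b (suc b)) swap-b g-perm) sa<c ⟩
        not (inversionParity c (swap b (suc b) ∘ g))
          ≡⟨ cong not (inversionParity-swap-adjacent g-perm sb<c) ⟩
        not (not (inversionParity c g))
          ≡⟨ not-involutive _ ⟩
        inversionParity c g ∎
    ; back         = λ {_} {y} y-side →
        subst (Side _) (sym (ρ-low-fixes (low-label≤h a+sd≡h) (<-≤-trans t₁<c (c≤-Side y-side)))) y-side
    }
    where
    open ≡-Reasoning
    b : ℕ
    b = h + suc d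
    sb<c : suc b < c
    sb<c = ≤-<-trans (low-edge<t₁ a+sd≡h) t₁<c
    sa<c : suc a < c
    sa<c = ≤-<-trans (low-index<h a+sd≡h) (<-trans (m<m+n h z<s) t₁<c)
    swap-a : ∀ {x} → x < c → swap a (suc a) x < c
    swap-a = swap-preserves (_< c) (<-trans (n<1+n a) sa<c) sa<c
    swap-b : ∀ {x} → x < c → swap b (suc b) x < c
    swap-b = swap-preserves (_< c) (<-trans (n<1+n b) sb<c) sb<c

  respects-mid : Respects (ρ (suc h)) true
  respects-mid = record
    { front-closed = front-closed
    ; front-parity = λ {g} g-perm → trans
        (inversionParity-cong c (λ i<c → ρ-mid-front (PermutesBelow.<-closed g-perm i<c)))
        (inversionParity-swap-adjacent g-perm t₂<c)
    ; back         = crosses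
    }
    where
    front-closed : ∀ {x} → x < c → ρ (suc h) x < c
    front-closed x<c = subst (_< c) (sym (ρ-mid-front x<c)) (swap-preserves (_< c) t₁<c t₂<c x<c)
    crosses : ∀ {b y} → Side b y → Side (not b) (ρ (suc h) y)
    crosses {false} (c≤y , y≤T) with rung-index c≤y y≤T
    ... | k , k<2+m , refl = subst (Side true) (sym (ρ-rung k<2+m)) (T<s k , s≤top k<2+m)
    crosses {true} (T<y , y≤top) with s-index T<y y≤top
    ... | k , k<2+m , refl = subst (Side false) (sym (ρ-rung⁻ k<2+m)) (m≤n+m c k , rung≤T k<2+m)

  respects-high : ∀ {k} → k ≤ m → Respects (ρ (3 + h + k)) false
  respects-high {k} k≤m = record
    { front-closed = λ x<c → subst (_< c) (sym (ρ-high-front k≤m x<c)) x<c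
    ; front-parity = λ {g} g-perm →
        inversionParity-cong c (λ i<c → ρ-high-front k≤m (PermutesBelow.<-closed g-perm i<c))
    ; back         = stays
    }
    where
    k+c<T : suc (k + c) ≤ T
    k+c<T = rung≤T (s≤s (s≤s k≤m))
    stays : ∀ {b y} → Side b y → Side b (ρ (3 + h + k) y)
    stays {false} {y} y-side@(_ , y≤T) = subst (Side false) (sym ρy≡)
      (swap-preserves (Side false) (m≤n+m c k , <⇒≤ k+c<T) (≤-trans (m≤n+m c k) (n≤1+n _) , k+c<T) y-side)
      where
      y<s : y < s k
      y<s = ≤-<-trans y≤T (T<s k)
      ρy≡ : ρ (3 + h + k) y ≡ swap (k + c) (suc (k + c)) y
      ρy≡ = trans (ρ-high k≤m y)
        (cong (swap (k + c) (suc (k + c))) (swap-other (<⇒≢ y<s) (<⇒≢ (<-trans y<s (n<1+n (s k))))))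
    stays {true} {y} y-side = subst (Side true) (sym ρy≡) z-side
      where
      z : ℕ
      z = swap (s k) (suc (s k)) y
      z-side : Side true z
      z-side = swap-preserves (Side true) (T<s k , s≤top (s≤s (m≤n⇒m≤1+n k≤m)))
                 (<-trans (T<s k) (n<1+n _) , s≤top (s≤s (s≤s k≤m))) y-side
      ρy≡ : ρ (3 + h + k) y ≡ z
      ρy≡ = trans (ρ-high k≤m y)
        (swap-other (>⇒≢ (<-trans k+c<T (proj₁ z-side))) (>⇒≢ (≤-<-trans k+c<T (proj₁ z-side))))

  respects : ∀ {l} → l < r → l ≢ 0 → l ≢ 2 + h → ∃ (Respects (ρ l))
  respects {l} l<r l≢0 l≢2+h with classify l
  ... | origin = ⊥-elim (l≢0 refl)
  ... | low a d a+sd≡h = false , respects-low a+sd≡h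
  ... | mid = true , respects-mid
  ... | joint = ⊥-elim (l≢2+h refl)
  ... | high k k≤m = false , respects-high k≤m
  ... | unused r≤l = ⊥-elim (<⇒≱ l<r r≤l)

  without : ∀ {l₀} → l₀ < r → Subset r
  without l₀<r = ∁ ⁅ fromℕ< l₀<r ⁆

  ∈-without : ∀ {l l₀} (l<r : l < r) (l₀<r : l₀ < r) → l ≢ l₀ → fromℕ< l<r ∈ without l₀<r
  ∈-without l<r l₀<r l≢l₀ = x∉p⇒x∈∁p (x≢y⇒x∉⁅y⁆ λ eq →
    l≢l₀ (trans (sym (toℕ-fromℕ< l<r)) (trans (cong toℕ eq) (toℕ-fromℕ< l₀<r))))

  without-∌ : ∀ {l₀} (l₀<r : l₀ < r) {i} → i ∈ without l₀<r → toℕ i ≢ l₀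
  without-∌ l₀<r i∈ i≡l₀ = x∈∁p⇒x∉p i∈
    (subst (_∈ ⁅ fromℕ< l₀<r ⁆) (sym (toℕ-injective (trans i≡l₀ (sym (toℕ-fromℕ< l₀<r))))) (x∈⁅x⁆ _))

  I J : Subset r
  I = without 2+h<r
  J = without 0<r

  Linked-evalWord : ∀ {w} → All (_∈ I ∩ J) w → Linked (evalWord (generators r (G′ r h)) w)
  Linked-evalWord [] = Linked-id
  Linked-evalWord {i ∷ _} (i∈I∩J ∷ w∈I∩J) =
    let (i∈I , i∈J) = x∈p∩q⁻ I J i∈I∩J
        (_ , i-respects) = respects (toℕ<n i) (without-∌ 0<r i∈J) (without-∌ 2+h<r i∈I)
    in Linked-∘ (ρ-involutive (toℕ i)) i-respects (Linked-evalWord w∈I∩J)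

  t₁-t₂∉⟨I∩J⟩ : ¬ Transposes (I ∩ J) t₁ t₂
  t₁-t₂∉⟨I∩J⟩ (w , w∈I∩J , w≐swap) = <⇒≱ (proj₁ c-side) c≤T
    where
    odd : inversionParity c (evalWord _ w) ≡ true
    odd = begin
      inversionParity c (evalWord _ w) ≡⟨ inversionParity-cong c (λ _ → w≐swap _) ⟩
      inversionParity c (swap t₁ t₂)   ≡⟨ inversionParity-swap-adjacent (PermutesBelow-id c) t₂<c ⟩
      not (inversionParity c id)       ≡⟨ cong not (inversionParity-id c) ⟩
      true                             ∎
      where open ≡-Reasoning
    c-side : Side true c
    c-side = subst₂ Side odd (trans (w≐swap c) (swap-other (>⇒≢ t₁<c) (>⇒≢ t₂<c)))
                   (Linked.side (Linked-evalWord w∈I∩J))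

  not-CPR : ¬ IsCPRGraph r (G′ r h)
  not-CPR cpr = t₁-t₂∉⟨I∩J⟩ (IsStringCGroup.intersection cpr I J (swap t₁ t₂)
    (transposes-t₁-t₂-left λ l<r l≤sh → ∈-without l<r 2+h<r λ l≡2+h → 1+n≰n (subst (_≤ suc h) l≡2+h l≤sh))
    (transposes-t₁-t₂-right λ l<r h≤l _ → ∈-without l<r 0<r λ l≡0 → <⇒≱ 1≤h (subst (h ≤_) l≡0 h≤l)))

  iso : IsoToSymmetric (generators r (G′ r h)) (2 * r ∸ 1)
  iso = isoToSymmetric _ (λ i → ρ-involutive (toℕ i))
    (λ i x≮n → ρ-fixes-beyond (toℕ i) (≰⇒> (x≮n ∘ below)))
    (λ a<n b<n → transposes-top (at-most-top a<n) (at-most-top b<n))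
    where
    n≡ : 2 * r ∸ 1 ≡ suc top
    n≡ = cong (_∸ 1) (vertex-count h m)
    at-most-top : ∀ {x} → x < 2 * r ∸ 1 → x ≤ top
    at-most-top {x} x<n = ≤-pred (subst (x <_) n≡ x<n)
    below : ∀ {x} → x ≤ top → x < 2 * r ∸ 1
    below {x} x≤top = subst (x <_) (sym n≡) (s≤s x≤top)

-- 5 ≤ r already follows from 1 ≤ h and h + 4 ≤ r.
proposition4p8 : (r h : ℕ) → 5 ≤ r → 1 ≤ h → h + 4 ≤ r →
    ¬ IsCPRGraph r (G′ r h) × IsoToSymmetric (generators r (G′ r h)) (2 * r ∸ 1)
proposition4p8 r h _ 1≤h h+4≤r with m≤n⇒∃[o]m+o≡n h+4≤r
... | m , refl = Graph.not-CPR h m 1≤h , Graph.iso h m 1≤h
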